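{- Let $m$ be a positive integer. Every Ferrers board is $m$-level rook equivalent to a unique $m$-restricted singleton board.
   Context: A Ferrers board with column heights $0\le b_1\le\dots\le b_n$ is the set of the $b_j$ lowest cells of column $j$ in the first-quadrant grid; boards are sets of cells, so left zero columns may be added or removed. The $i$th level is rows $(i-1)m+1,\dots,im$; an $m$-level rook placement is a set of cells of $B$ no two in the same level or column; $r_{k,m}(B)$ counts those with $k$ cells; $B,B'$ are $m$-level rook equivalent if $r_{k,m}(B)=r_{k,m}(B')$ for all $k$. $\lfloor n\rfloor_m$ is the largest multiple of $m$ that is $\le n$. $B$ is a singleton board if for all $i<n$, $\lfloor b_i\rfloor_m\ne b_i$ implies $\lfloor b_{i+1}\rfloor_m>\lfloor b_i\rfloor_m$. $B$ is $m$-restricted if, written as $(b_0,b_1,\dots,b_n)$ with $b_0=0$, $b_{j+1}\le b_j+m$ for all $j\ge0$. -}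

module Defs where

open import Data.Nat using (ℕ; zero; suc; _+_; _*_; _≤_; _<_; _≟_; NonZero)
open import Data.Nat.DivMod using (_/_)
open import Data.List using (List; []; _∷_; map; concatMap; length; filter; mapMaybe; upTo; dropWhile)
open import Data.Maybe using (Maybe; just; nothing)
open import Data.List.Relation.Unary.Linked using (Linked)
open import Data.List.Relation.Unary.Unique.Propositional using (Unique)
import Data.List.Relation.Unary.Unique.DecPropositional as UDec
open import Relation.Binary.PropositionalEquality using (_≡_; _≢_)
open import Relation.Nullary.Decidable using (Dec)

-- A (Ferrers) board is given by its list of column heights (b₁,…,bₙ).
-- It is a Ferrers board when the heights are weakly increasing.
IsFerrers : List ℕ → Set
IsFerrers = Linked _≤_

-- Boards are sets of cells: two height lists denote the same board iff they
-- agree after removing leading zero columns.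
stripZeros : List ℕ → List ℕ
stripZeros = dropWhile (λ b → b ≟ 0)

SameBoard : List ℕ → List ℕ → Set
SameBoard B C = stripZeros B ≡ stripZeros C

-- A candidate placement assigns to each column either no cell or a cell,
-- given by its row index r, 0-based (so r = 0 is row 1, the lowest row).
-- A set of cells of B with at most one cell per column corresponds exactly
-- to such a list.
placements : List ℕ → List (List (Maybe ℕ))
placements [] = [] ∷ []
placements (b ∷ bs) =
  concatMap (λ p → (nothing ∷ p) ∷ map (λ r → just r ∷ p) (upTo b)) (placements bs)

-- Level of the 0-based row r: row r+1 lies in level ⌊r/m⌋+1; we use the
-- 0-based level index ⌊r/m⌋.
levels : (m : ℕ) .{{_ : NonZero m}} → List (Maybe ℕ) → List ℕ
levels m p = mapMaybe (Data.Maybe.map (λ r → r / m)) p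
  where import Data.Maybe

size : List (Maybe ℕ) → ℕ
size p = length (mapMaybe (λ x → x) p)

-- m-level rook placements: no two cells in the same level (columns are
-- distinct by construction).
rookPlacements : (m : ℕ) .{{_ : NonZero m}} → List ℕ → List (List (Maybe ℕ))
rookPlacements m B = filter (λ p → UDec.unique? _≟_ (levels m p)) (placements B)

rookNumber : (k m : ℕ) .{{_ : NonZero m}} → List ℕ → ℕ
rookNumber k m B = length (filter (λ p → size p ≟ k) (rookPlacements m B))

RookEquiv : (m : ℕ) .{{_ : NonZero m}} → List ℕ → List ℕ → Set
RookEquiv m B C = ∀ k → rookNumber k m B ≡ rookNumber k m C

floorM : (m : ℕ) .{{_ : NonZero m}} → ℕ → ℕ
floorM m n = (n / m) * m

Singleton : (m : ℕ) .{{_ : NonZero m}} → List ℕ → Set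
Singleton m = Linked (λ a b → floorM m a ≢ a → floorM m a < floorM m b)

Restricted : (m : ℕ) → List ℕ → Set
Restricted m B = Linked (λ a b → b ≤ a + m) (0 ∷ B)

module Submission where

-- Rook numbers are computed by a recursion G over the columns that remembers
-- the levels already used (Counting).  Moving cells between two columns of the
-- same band of levels q·m … (q+1)·m does not change G (PairMoves); with such
-- moves every Ferrers board becomes a singleton board with the same counts
-- (SingletonBoards).  On singleton boards G obeys an integer recursion g
-- (FactorizationTheorem), whose expansion in the m-falling factorial basis is
-- the product P B Y = ∏ᵢ (Y + bᵢ − (i−1)·m).  That basis is triangular at the
-- points t·m, so equal rook numbers and equal polynomials are interchangeable,
-- and P determines an m-restricted board through its roots (Polynomial).
-- Finally, the columns of a singleton board, padded with empty columns, are
-- settled one by one into an m-restricted singleton board by exchanges that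
-- only permute the linear factors of P (Settling, SettlingPolynomial).

open import Defs
open import Data.Nat using (ℕ; NonZero)
open import Data.List using (List)
open import Data.Product using (Σ; _×_; _,_; proj₁; proj₂)
open import Algebra.Bundles using (CommutativeSemiring)

module FiniteSum {c ℓ} (R : CommutativeSemiring c ℓ) where

  open import Algebra.Properties.CommutativeSemigroup using (interchange)
  open import Data.Nat as ℕ using (ℕ; zero; suc; z<s; s<s)
  open import Function using (_∘_)
  open CommutativeSemiring R

  ∑< : ℕ → (ℕ → Carrier) → Carrier
  ∑< zero    f = 0#
  ∑< (suc n) f = f 0 + ∑< n (f ∘ suc)

  ∑<-cong : ∀ n {f g : ℕ → Carrier} → (∀ i → i ℕ.< n → f i ≈ g i) → ∑< n f ≈ ∑< n g
  ∑<-cong zero    eq = refl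
  ∑<-cong (suc n) eq = +-cong (eq 0 z<s) (∑<-cong n (λ i i<n → eq (suc i) (s<s i<n)))

  ∑<-zero : ∀ n → ∑< n (λ _ → 0#) ≈ 0#
  ∑<-zero zero    = refl
  ∑<-zero (suc n) = trans (+-identityˡ _) (∑<-zero n)

  ∑<-+ : ∀ n (f g : ℕ → Carrier) → ∑< n (λ i → f i + g i) ≈ ∑< n f + ∑< n g
  ∑<-+ zero    f g = sym (+-identityˡ 0#)
  ∑<-+ (suc n) f g = trans (+-congˡ (∑<-+ n (f ∘ suc) (g ∘ suc))) (interchange +-commutativeSemigroup _ _ _ _)

  ∑<-*ˡ : ∀ n x (f : ℕ → Carrier) → ∑< n (λ i → x * f i) ≈ x * ∑< n f
  ∑<-*ˡ zero    x f = sym (zeroʳ x)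
  ∑<-*ˡ (suc n) x f = trans (+-congˡ (∑<-*ˡ n x (f ∘ suc))) (sym (distribˡ x _ _))

  ∑<-split : ∀ a b (f : ℕ → Carrier) → ∑< (a ℕ.+ b) f ≈ ∑< a f + ∑< b (λ i → f (a ℕ.+ i))
  ∑<-split zero    b f = sym (+-identityˡ _)
  ∑<-split (suc a) b f = trans (+-congˡ (∑<-split a b (f ∘ suc))) (sym (+-assoc _ _ _))

module Counting where

  open import Algebra.Bundles using (CommutativeMonoid)
  import Algebra.Properties.CommutativeSemigroup as CommSemigroupProps
  open import Data.Bool using (Bool; true; false; not; _∧_; _∨_; if_then_else_)
  open import Data.Bool.ListAction using (all)
  open import Data.Bool.Properties using (∧-zeroʳ; ∧-comm; ∧-assoc; ∧-commutativeMonoid)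
  open import Data.List using (List; []; _∷_; _++_; map; concatMap; filter; length; applyUpTo; upTo)
  open import Data.List.Relation.Unary.All using (all?)
  import Data.List.Relation.Unary.Unique.DecPropositional as UDec
  open import Data.Maybe using (Maybe; just; nothing)
  open import Data.Nat using (ℕ; zero; suc; _+_; _*_; _≡ᵇ_; _≟_; _/_; NonZero)
  import Data.Nat.Properties as ℕP
  open import Function using (_∘_)
  open import Relation.Binary.PropositionalEquality
  open import Relation.Nullary using (does; ¬?)
  open import Relation.Unary using (Decidable)
  open CommSemigroupProps ℕP.+-commutativeSemigroup using () renaming (interchange to +-interchange)
  open CommSemigroupProps (CommutativeMonoid.commutativeSemigroup ∧-commutativeMonoid) using ()
    renaming (interchange to ∧-interchange)

  open FiniteSum ℕP.+-*-commutativeSemiring public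

  ∑<-const : ∀ n c → ∑< n (λ _ → c) ≡ n * c
  ∑<-const zero    c = refl
  ∑<-const (suc n) c = cong (c +_) (∑<-const n c)

  indicator : Bool → ℕ
  indicator true  = 1
  indicator false = 0

  count : {A : Set} → (A → Bool) → List A → ℕ
  count f []       = 0
  count f (x ∷ xs) = indicator (f x) + count f xs

  length-filter : {A : Set} {P : A → Set} (P? : Decidable P) (xs : List A) →
    length (filter P? xs) ≡ count (does ∘ P?) xs
  length-filter P? [] = refl
  length-filter P? (x ∷ xs) with does (P? x)
  ... | true  = cong suc (length-filter P? xs)
  ... | false = length-filter P? xs

  count-filter : {A : Set} {P : A → Set} (P? : Decidable P) (f : A → Bool) (xs : List A) →
    count f (filter P? xs) ≡ count (λ x → does (P? x) ∧ f x) xs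
  count-filter P? f [] = refl
  count-filter P? f (x ∷ xs) with does (P? x)
  ... | true  = cong (indicator (f x) +_) (count-filter P? f xs)
  ... | false = count-filter P? f xs

  count-cong : {A : Set} {f g : A → Bool} → (∀ x → f x ≡ g x) → (xs : List A) → count f xs ≡ count g xs
  count-cong eq []       = refl
  count-cong eq (x ∷ xs) = cong₂ _+_ (cong indicator (eq x)) (count-cong eq xs)

  count-false : {A : Set} (xs : List A) → count (λ _ → false) xs ≡ 0
  count-false []       = refl
  count-false (x ∷ xs) = count-false xs

  count-++ : {A : Set} (f : A → Bool) (xs ys : List A) → count f (xs ++ ys) ≡ count f xs + count f ys
  count-++ f []       ys = refl
  count-++ f (x ∷ xs) ys = trans (cong (indicator (f x) +_) (count-++ f xs ys)) (sym (ℕP.+-assoc (indicator (f x)) _ _))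

  count-map-applyUpTo : {A B : Set} (f : B → Bool) (g : A → B) (h : ℕ → A) (n : ℕ) →
    count f (map g (applyUpTo h n)) ≡ ∑< n (λ i → indicator (f (g (h i))))
  count-map-applyUpTo f g h zero    = refl
  count-map-applyUpTo f g h (suc n) = cong (indicator (f (g (h 0))) +_) (count-map-applyUpTo f g (h ∘ suc) n)

  extensions : ℕ → List (Maybe ℕ) → List (List (Maybe ℕ))
  extensions b p = (nothing ∷ p) ∷ map (λ r → just r ∷ p) (upTo b)

  count-extensions : (f : List (Maybe ℕ) → Bool) (b : ℕ) (ps : List (List (Maybe ℕ))) →
    count f (concatMap (extensions b) ps) ≡
    count (λ p → f (nothing ∷ p)) ps + ∑< b (λ r → count (λ p → f (just r ∷ p)) ps)
  count-extensions f b []       = sym (∑<-zero b)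
  count-extensions f b (p ∷ ps) = begin
      count f (extensions b p ++ concatMap (extensions b) ps)
    ≡⟨ count-++ f (extensions b p) _ ⟩
      indicator (f (nothing ∷ p)) + count f (map (λ r → just r ∷ p) (upTo b)) + count f (concatMap (extensions b) ps)
    ≡⟨ cong₂ (λ x y → indicator (f (nothing ∷ p)) + x + y)
             (count-map-applyUpTo f (λ r → just r ∷ p) (λ r → r) b) (count-extensions f b ps) ⟩
      indicator (f (nothing ∷ p)) + ∑< b (λ r → indicator (f (just r ∷ p)))
        + (count (λ q → f (nothing ∷ q)) ps + ∑< b (λ r → count (λ q → f (just r ∷ q)) ps))
    ≡⟨ +-interchange (indicator (f (nothing ∷ p))) _ _ _ ⟩
      count (λ q → f (nothing ∷ q)) (p ∷ ps)
        + (∑< b (λ r → indicator (f (just r ∷ p))) + ∑< b (λ r → count (λ q → f (just r ∷ q)) ps))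
    ≡⟨ cong (count (λ q → f (nothing ∷ q)) (p ∷ ps) +_) (sym (∑<-+ b _ _)) ⟩
      count (λ q → f (nothing ∷ q)) (p ∷ ps) + ∑< b (λ r → count (λ q → f (just r ∷ q)) (p ∷ ps))
    ∎
    where open ≡-Reasoning

  mem : ℕ → List ℕ → Bool
  mem x []      = false
  mem x (y ∷ U) = (y ≡ᵇ x) ∨ mem x U

  freshLevels : List ℕ → List ℕ → Bool
  freshLevels U []      = true
  freshLevels U (l ∷ L) = not (mem l U) ∧ freshLevels (l ∷ U) L

  avoids : List ℕ → List ℕ → Bool
  avoids U = all (λ l → not (mem l U))

  avoids-cons : ∀ l U L → avoids (l ∷ U) L ≡ all (λ y → not (l ≡ᵇ y)) L ∧ avoids U L
  avoids-cons l U []      = refl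
  avoids-cons l U (y ∷ L) =
    trans (cong₂ _∧_ (not-∨ (l ≡ᵇ y) (mem y U)) (avoids-cons l U L))
          (∧-interchange (not (l ≡ᵇ y)) (not (mem y U)) _ _)
    where
    not-∨ : ∀ a b → not (a ∨ b) ≡ not a ∧ not b
    not-∨ true  b = refl
    not-∨ false b = refl

  does-all-distinct : ∀ x L → does (all? (λ y → ¬? (x ≟ y)) L) ≡ all (λ y → not (x ≡ᵇ y)) L
  does-all-distinct x []      = refl
  does-all-distinct x (y ∷ L) = cong (not (x ≡ᵇ y) ∧_) (does-all-distinct x L)

  freshLevels-unique : ∀ U L → freshLevels U L ≡ avoids U L ∧ does (UDec.unique? _≟_ L)
  freshLevels-unique U []      = refl
  freshLevels-unique U (l ∷ L) = begin
      not (mem l U) ∧ freshLevels (l ∷ U) L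
    ≡⟨ cong (not (mem l U) ∧_) (freshLevels-unique (l ∷ U) L) ⟩
      not (mem l U) ∧ (avoids (l ∷ U) L ∧ unique L)
    ≡⟨ cong (λ z → not (mem l U) ∧ (z ∧ unique L)) (avoids-cons l U L) ⟩
      not (mem l U) ∧ ((distinct ∧ avoids U L) ∧ unique L)
    ≡⟨ shuffle (not (mem l U)) distinct (avoids U L) (unique L) ⟩
      (not (mem l U) ∧ avoids U L) ∧ (distinct ∧ unique L)
    ≡⟨ cong (λ z → (not (mem l U) ∧ avoids U L) ∧ (z ∧ unique L)) (sym (does-all-distinct l L)) ⟩
      avoids U (l ∷ L) ∧ unique (l ∷ L)
    ∎
    where
    open ≡-Reasoning
    unique : List ℕ → Bool
    unique L = does (UDec.unique? _≟_ L)
    distinct : Bool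
    distinct = all (λ y → not (l ≡ᵇ y)) L
    shuffle : ∀ a b c d → a ∧ ((b ∧ c) ∧ d) ≡ (a ∧ c) ∧ (b ∧ d)
    shuffle a b c d = begin
      a ∧ ((b ∧ c) ∧ d) ≡⟨ cong (λ z → a ∧ (z ∧ d)) (∧-comm b c) ⟩
      a ∧ ((c ∧ b) ∧ d) ≡⟨ cong (a ∧_) (∧-assoc c b d) ⟩
      a ∧ (c ∧ (b ∧ d)) ≡⟨ sym (∧-assoc a c (b ∧ d)) ⟩
      (a ∧ c) ∧ (b ∧ d) ∎

  freshLevels-[] : ∀ L → freshLevels [] L ≡ does (UDec.unique? _≟_ L)
  freshLevels-[] L = trans (freshLevels-unique [] L) (cong (_∧ does (UDec.unique? _≟_ L)) (avoids-[] L))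
    where
    avoids-[] : ∀ L → avoids [] L ≡ true
    avoids-[] []      = refl
    avoids-[] (l ∷ L) = avoids-[] L

  module RookNumbers (m : ℕ) .{{_ : NonZero m}} where

    -- G B U k counts the k-cell placements on the columns B whose levels are
    -- pairwise distinct and avoid the already used levels U.
    G : List ℕ → List ℕ → ℕ → ℕ
    G []       U zero    = 1
    G []       U (suc k) = 0
    G (b ∷ bs) U zero    = G bs U zero
    G (b ∷ bs) U (suc k) = G bs U (suc k) + ∑< b (λ r → if mem (r / m) U then 0 else G bs (r / m ∷ U) k)

    admissible : List ℕ → ℕ → List (Maybe ℕ) → Bool
    admissible U k p = freshLevels U (levels m p) ∧ (size p ≡ᵇ k)

    count-guard : ∀ (c : Bool) (f g : List (Maybe ℕ) → Bool) ps →
      count (λ p → (not c ∧ f p) ∧ g p) ps ≡ (if c then 0 else count (λ p → f p ∧ g p) ps)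
    count-guard true  f g ps = count-false ps
    count-guard false f g ps = refl

    count-admissible : ∀ B U k → count (admissible U k) (placements B) ≡ G B U k
    count-admissible []       U zero    = refl
    count-admissible []       U (suc k) = refl
    count-admissible (b ∷ bs) U zero    = begin
        count (admissible U 0) (placements (b ∷ bs))
      ≡⟨ count-extensions (admissible U 0) b (placements bs) ⟩
        count (admissible U 0) (placements bs) + ∑< b (λ r → count (λ p → admissible U 0 (just r ∷ p)) (placements bs))
      ≡⟨ cong₂ _+_ (count-admissible bs U 0) noCell ⟩
        G bs U 0 + 0
      ≡⟨ ℕP.+-identityʳ (G bs U 0) ⟩
        G bs U 0
      ∎
      where
      open ≡-Reasoning
      -- a placement with a cell in the first column is not empty
      noCell : ∑< b (λ r → count (λ p → admissible U 0 (just r ∷ p)) (placements bs)) ≡ 0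
      noCell = trans (∑<-cong b (λ r _ → trans (count-cong (λ p → ∧-zeroʳ _) (placements bs))
                                                (count-false (placements bs))))
                     (∑<-zero b)
    count-admissible (b ∷ bs) U (suc k) =
      trans (count-extensions (admissible U (suc k)) b (placements bs))
            (cong₂ _+_ (count-admissible bs U (suc k)) (∑<-cong b (λ r _ → oneCell r)))
      where
      oneCell : ∀ r → count (λ p → admissible U (suc k) (just r ∷ p)) (placements bs)
                    ≡ (if mem (r / m) U then 0 else G bs (r / m ∷ U) k)
      oneCell r = trans (count-guard (mem (r / m) U) (λ p → freshLevels (r / m ∷ U) (levels m p))
                                     (λ p → size p ≡ᵇ k) (placements bs))
                        (cong (if mem (r / m) U then 0 else_) (count-admissible bs (r / m ∷ U) k))

    rookNumber-G : ∀ k B → rookNumber k m B ≡ G B [] k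
    rookNumber-G k B = begin
        length (filter (λ p → size p ≟ k) (rookPlacements m B))
      ≡⟨ length-filter (λ p → size p ≟ k) (rookPlacements m B) ⟩
        count (λ p → size p ≡ᵇ k) (rookPlacements m B)
      ≡⟨ count-filter (λ p → UDec.unique? _≟_ (levels m p)) (λ p → size p ≡ᵇ k) (placements B) ⟩
        count (λ p → does (UDec.unique? _≟_ (levels m p)) ∧ (size p ≡ᵇ k)) (placements B)
      ≡⟨ count-cong (λ p → cong (_∧ (size p ≡ᵇ k)) (sym (freshLevels-[] (levels m p)))) (placements B) ⟩
        count (admissible [] k) (placements B)
      ≡⟨ count-admissible B [] k ⟩
        G B [] k
      ∎
      where open ≡-Reasoning

-- Two columns q·m + s₁ and q·m + s₂ with s₁, s₂ ≤ m, lying in one band of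
-- levels, contribute to G only through s₁ + s₂.
module PairMoves where

  open Counting
  open import Data.Bool using (Bool; true; false; _∨_; if_then_else_)
  open import Data.Bool.Properties using (∨-comm; ∨-assoc)
  open import Data.List using (List; []; _∷_)
  open import Data.Nat using (ℕ; zero; suc; _+_; _*_; _≡ᵇ_; _/_; _≤_; NonZero)
  open import Data.Nat.Properties
  open import Data.Nat.DivMod using (m<n⇒m/n≡0; +-distrib-/-∣ʳ; n/n≡1)
  open import Data.Nat.Divisibility using (∣-refl)
  open import Data.Nat.Tactic.RingSolver using (solve-∀)
  open import Relation.Binary.PropositionalEquality

  ≡ᵇ-refl : ∀ x → (x ≡ᵇ x) ≡ true
  ≡ᵇ-refl zero    = refl
  ≡ᵇ-refl (suc x) = ≡ᵇ-refl x

  ≡ᵇ-sym : ∀ x y → (x ≡ᵇ y) ≡ (y ≡ᵇ x)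
  ≡ᵇ-sym zero    zero    = refl
  ≡ᵇ-sym zero    (suc y) = refl
  ≡ᵇ-sym (suc x) zero    = refl
  ≡ᵇ-sym (suc x) (suc y) = ≡ᵇ-sym x y

  mem-swap : ∀ x a b U → mem x (a ∷ b ∷ U) ≡ mem x (b ∷ a ∷ U)
  mem-swap x a b U = trans (sym (∨-assoc (a ≡ᵇ x) (b ≡ᵇ x) (mem x U)))
    (trans (cong (_∨ mem x U) (∨-comm (a ≡ᵇ x) (b ≡ᵇ x))) (∨-assoc (b ≡ᵇ x) (a ≡ᵇ x) (mem x U)))

  if-0 : ∀ (c : Bool) → (if c then 0 else 0) ≡ 0
  if-0 true  = refl
  if-0 false = refl

  if-+ : ∀ (c : Bool) x y → (if c then 0 else x + y) ≡ (if c then 0 else x) + (if c then 0 else y)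
  if-+ true  x y = refl
  if-+ false x y = refl

  if-∑< : ∀ (c : Bool) n f → (if c then 0 else ∑< n f) ≡ ∑< n (λ i → if c then 0 else f i)
  if-∑< true  n f = sym (∑<-zero n)
  if-∑< false n f = refl

  module PairMove (m : ℕ) .{{_ : NonZero m}} where
    open RookNumbers m

    G-mem-cong : ∀ R {U V} k → (∀ x → mem x U ≡ mem x V) → G R U k ≡ G R V k
    G-mem-cong []      zero    eq = refl
    G-mem-cong []      (suc k) eq = refl
    G-mem-cong (b ∷ R) zero    eq = G-mem-cong R zero eq
    G-mem-cong (b ∷ R) {U} {V} (suc k) eq = cong₂ _+_ (G-mem-cong R (suc k) eq) (∑<-cong b (λ r _ → atLevel (r / m)))
      where
      atLevel : ∀ l → (if mem l U then 0 else G R (l ∷ U) k) ≡ (if mem l V then 0 else G R (l ∷ V) k)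
      atLevel l rewrite eq l with mem l V
      ... | true  = refl
      ... | false = G-mem-cong R k (λ x → cong ((l ≡ᵇ x) ∨_) (eq x))

    free₁ : List ℕ → List ℕ → ℕ → ℕ → ℕ
    free₁ R U k l = if mem l U then 0 else G R (l ∷ U) k

    free₂ : List ℕ → List ℕ → ℕ → ℕ → ℕ → ℕ
    free₂ R U k l l′ = if mem l U then 0 else free₁ R (l ∷ U) k l′

    free₂-sym : ∀ R U k l l′ → free₂ R U k l l′ ≡ free₂ R U k l′ l
    free₂-sym R U k l l′ rewrite ≡ᵇ-sym l′ l with mem l U | mem l′ U | l ≡ᵇ l′
    ... | true  | true  | _     = refl
    ... | true  | false | true  = refl
    ... | true  | false | false = refl
    ... | false | true  | true  = refl
    ... | false | true  | false = refl
    ... | false | false | true  = refl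
    ... | false | false | false = G-mem-cong R k (λ x → mem-swap x l′ l U)

    free₂-diag : ∀ R U k l → free₂ R U k l l ≡ 0
    free₂-diag R U k l rewrite ≡ᵇ-refl l with mem l U
    ... | true  = refl
    ... | false = refl

    Δ : ℕ → List ℕ → List ℕ → ℕ → ℕ
    Δ b R U zero    = 0
    Δ b R U (suc k) = ∑< b (λ r → free₁ R U k (r / m))

    G-cons : ∀ b R U k → G (b ∷ R) U k ≡ G R U k + Δ b R U k
    G-cons b R U zero    = sym (+-identityʳ _)
    G-cons b R U (suc k) = refl

    Cross : ℕ → ℕ → List ℕ → List ℕ → ℕ → ℕ
    Cross a b R U zero    = 0
    Cross a b R U (suc k) = ∑< a (λ r → if mem (r / m) U then 0 else Δ b R (r / m ∷ U) k)

    G-cons² : ∀ a b R U k → G (a ∷ b ∷ R) U k ≡ G R U k + (Δ a R U k + Δ b R U k) + Cross a b R U k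
    G-cons² a b R U k = begin
        G (a ∷ b ∷ R) U k
      ≡⟨ G-cons a (b ∷ R) U k ⟩
        G (b ∷ R) U k + Δ a (b ∷ R) U k
      ≡⟨ cong₂ _+_ (G-cons b R U k) (Δ-cons k) ⟩
        G R U k + Δ b R U k + (Δ a R U k + Cross a b R U k)
      ≡⟨ rearrange (G R U k) (Δ b R U k) (Δ a R U k) (Cross a b R U k) ⟩
        G R U k + (Δ a R U k + Δ b R U k) + Cross a b R U k
      ∎
      where
      open ≡-Reasoning
      rearrange : ∀ g x y z → g + x + (y + z) ≡ g + (y + x) + z
      rearrange = solve-∀
      Δ-cons : ∀ k → Δ a (b ∷ R) U k ≡ Δ a R U k + Cross a b R U k
      Δ-cons zero    = refl
      Δ-cons (suc k) = trans (∑<-cong a (λ r _ → trans (cong (if mem (r / m) U then 0 else_) (G-cons b R (r / m ∷ U) k))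
                                                       (if-+ (mem (r / m) U) _ _)))
                             (∑<-+ a _ _)

    next-level : ∀ a → (a + m) / m ≡ suc (a / m)
    next-level a = trans (+-distrib-/-∣ʳ a (∣-refl {m})) (trans (cong (a / m +_) (n/n≡1 m)) (+-comm (a / m) 1))

    -- Summing a function of the level over the rows of a column of height
    -- q·m + s with s ≤ m: each of the q full levels occurs m times, level q
    -- occurs s times.
    levelSum : ∀ q s (F : ℕ → ℕ) → s ≤ m → ∑< (q * m + s) (λ r → F (r / m)) ≡ m * ∑< q F + s * F q
    levelSum zero s F s≤m = begin
        ∑< s (λ r → F (r / m))
      ≡⟨ ∑<-cong s (λ r r<s → cong F (m<n⇒m/n≡0 (<-≤-trans r<s s≤m))) ⟩
        ∑< s (λ _ → F 0)
      ≡⟨ ∑<-const s (F 0) ⟩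
        s * F 0
      ≡⟨ cong (_+ s * F 0) (sym (*-zeroʳ m)) ⟩
        m * 0 + s * F 0
      ∎
      where open ≡-Reasoning
    levelSum (suc q) s F s≤m = begin
        ∑< (m + q * m + s) (λ r → F (r / m))
      ≡⟨ cong (λ n → ∑< n (λ r → F (r / m))) (+-assoc m (q * m) s) ⟩
        ∑< (m + (q * m + s)) (λ r → F (r / m))
      ≡⟨ ∑<-split m (q * m + s) _ ⟩
        ∑< m (λ r → F (r / m)) + ∑< (q * m + s) (λ r → F ((m + r) / m))
      ≡⟨ cong₂ _+_ (levelSum zero m F ≤-refl) (trans (∑<-cong (q * m + s) (λ r _ → cong F (shifted r)))
                                                      (levelSum q s (λ l → F (suc l)) s≤m)) ⟩
        (m * 0 + m * F 0) + (m * ∑< q (λ l → F (suc l)) + s * F (suc q))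
      ≡⟨ collect m (F 0) (∑< q (λ l → F (suc l))) s (F (suc q)) ⟩
        m * (F 0 + ∑< q (λ l → F (suc l))) + s * F (suc q)
      ∎
      where
      open ≡-Reasoning
      shifted : ∀ r → (m + r) / m ≡ suc (r / m)
      shifted r = trans (cong (_/ m) (+-comm m r)) (next-level r)
      collect : ∀ m a b s c → (m * 0 + m * a) + (m * b + s * c) ≡ m * (a + b) + s * c
      collect = solve-∀

    -- The same for a double sum over two columns of heights q·m + s₁ and
    -- q·m + s₂, for a symmetric D vanishing on the diagonal at level q: the
    -- result depends on s₁ and s₂ only through s₁ + s₂.
    levelSum² : ∀ q s₁ s₂ (D : ℕ → ℕ → ℕ) → s₁ ≤ m → s₂ ≤ m →
      (∀ l l′ → D l l′ ≡ D l′ l) → D q q ≡ 0 →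
      ∑< (q * m + s₁) (λ r → ∑< (q * m + s₂) (λ r′ → D (r / m) (r′ / m)))
        ≡ m * (m * ∑< q (λ l → ∑< q (D l))) + (s₁ + s₂) * (m * ∑< q (D q))
    levelSum² q s₁ s₂ D s₁≤m s₂≤m D-sym D-diag = begin
        ∑< (q * m + s₁) (λ r → ∑< (q * m + s₂) (λ r′ → D (r / m) (r′ / m)))
      ≡⟨ ∑<-cong (q * m + s₁) (λ r _ → levelSum q s₂ (D (r / m)) s₂≤m) ⟩
        ∑< (q * m + s₁) (λ r → inner (r / m))
      ≡⟨ levelSum q s₁ inner s₁≤m ⟩
        m * ∑< q inner + s₁ * inner q
      ≡⟨ cong₂ (λ x y → m * x + s₁ * (m * A + s₂ * y)) innerSum D-diag ⟩
        m * (m * ΣΣ + s₂ * A) + s₁ * (m * A + s₂ * 0)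
      ≡⟨ collect m ΣΣ A s₁ s₂ ⟩
        m * (m * ΣΣ) + (s₁ + s₂) * (m * A)
      ∎
      where
      open ≡-Reasoning
      ΣΣ = ∑< q (λ l → ∑< q (D l))
      A  = ∑< q (D q)
      inner : ℕ → ℕ
      inner l = m * ∑< q (D l) + s₂ * D l q
      innerSum : ∑< q inner ≡ m * ΣΣ + s₂ * A
      innerSum = begin
          ∑< q inner
        ≡⟨ ∑<-+ q _ _ ⟩
          ∑< q (λ l → m * ∑< q (D l)) + ∑< q (λ l → s₂ * D l q)
        ≡⟨ cong₂ _+_ (∑<-*ˡ q m _) (trans (∑<-*ˡ q s₂ _) (cong (s₂ *_) (∑<-cong q (λ l _ → D-sym l q)))) ⟩
          m * ΣΣ + s₂ * A
        ∎
      collect : ∀ m x a s₁ s₂ →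
        m * (m * x + s₂ * a) + s₁ * (m * a + s₂ * 0) ≡ m * (m * x) + (s₁ + s₂) * (m * a)
      collect = solve-∀

    Δ-pair : ∀ q s₁ s₂ R U k → s₁ ≤ m → s₂ ≤ m →
      Δ (q * m + s₁) R U (suc k) + Δ (q * m + s₂) R U (suc k)
        ≡ m * ∑< q (free₁ R U k) + m * ∑< q (free₁ R U k) + (s₁ + s₂) * free₁ R U k q
    Δ-pair q s₁ s₂ R U k s₁≤m s₂≤m =
      trans (cong₂ _+_ (levelSum q s₁ (free₁ R U k) s₁≤m) (levelSum q s₂ (free₁ R U k) s₂≤m))
            (collect (m * ∑< q (free₁ R U k)) (free₁ R U k q) s₁ s₂)
      where
      collect : ∀ c x s₁ s₂ → (c + s₁ * x) + (c + s₂ * x) ≡ c + c + (s₁ + s₂) * x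
      collect = solve-∀

    pairCount : ℕ → ℕ → List ℕ → List ℕ → ℕ → ℕ
    pairCount q s R U zero          = G R U zero
    pairCount q s R U (suc zero)    =
      G R U 1 + (m * ∑< q (free₁ R U 0) + m * ∑< q (free₁ R U 0) + s * free₁ R U 0 q)
    pairCount q s R U (suc (suc k)) =
      G R U (suc (suc k)) + (m * ∑< q (free₁ R U (suc k)) + m * ∑< q (free₁ R U (suc k)) + s * free₁ R U (suc k) q)
        + (m * (m * ∑< q (λ l → ∑< q (free₂ R U k l))) + s * (m * ∑< q (free₂ R U k q)))

    G-pair : ∀ q s₁ s₂ R U k → s₁ ≤ m → s₂ ≤ m →
      G (q * m + s₁ ∷ q * m + s₂ ∷ R) U k ≡ pairCount q (s₁ + s₂) R U k
    G-pair q s₁ s₂ R U zero          _    _    = refl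
    G-pair q s₁ s₂ R U (suc zero)    s₁≤m s₂≤m = begin
        G (q * m + s₁ ∷ q * m + s₂ ∷ R) U 1
      ≡⟨ G-cons² (q * m + s₁) (q * m + s₂) R U 1 ⟩
        G R U 1 + (Δ (q * m + s₁) R U 1 + Δ (q * m + s₂) R U 1) + Cross (q * m + s₁) (q * m + s₂) R U 1
      ≡⟨ cong₂ (λ x y → G R U 1 + x + y) (Δ-pair q s₁ s₂ R U 0 s₁≤m s₂≤m) noCross ⟩
        G R U 1 + (m * ∑< q (free₁ R U 0) + m * ∑< q (free₁ R U 0) + (s₁ + s₂) * free₁ R U 0 q) + 0
      ≡⟨ +-identityʳ _ ⟩
        pairCount q (s₁ + s₂) R U 1
      ∎
      where
      open ≡-Reasoning
      noCross : Cross (q * m + s₁) (q * m + s₂) R U 1 ≡ 0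
      noCross = trans (∑<-cong (q * m + s₁) (λ r _ → if-0 (mem (r / m) U))) (∑<-zero (q * m + s₁))
    G-pair q s₁ s₂ R U (suc (suc k)) s₁≤m s₂≤m = begin
        G (q * m + s₁ ∷ q * m + s₂ ∷ R) U (suc (suc k))
      ≡⟨ G-cons² (q * m + s₁) (q * m + s₂) R U (suc (suc k)) ⟩
        G R U (suc (suc k)) + (Δ (q * m + s₁) R U (suc (suc k)) + Δ (q * m + s₂) R U (suc (suc k)))
          + Cross (q * m + s₁) (q * m + s₂) R U (suc (suc k))
      ≡⟨ cong₂ (λ x y → G R U (suc (suc k)) + x + y) (Δ-pair q s₁ s₂ R U (suc k) s₁≤m s₂≤m) cross ⟩
        pairCount q (s₁ + s₂) R U (suc (suc k))
      ∎
      where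
      open ≡-Reasoning
      cross : Cross (q * m + s₁) (q * m + s₂) R U (suc (suc k))
            ≡ m * (m * ∑< q (λ l → ∑< q (free₂ R U k l))) + (s₁ + s₂) * (m * ∑< q (free₂ R U k q))
      cross = trans (∑<-cong (q * m + s₁) (λ r _ → if-∑< (mem (r / m) U) (q * m + s₂) _))
                    (levelSum² q s₁ s₂ (free₂ R U k) s₁≤m s₂≤m (free₂-sym R U k) (free₂-diag R U k q))

    pairMove : ∀ q s₁ s₂ t₁ t₂ R U k → s₁ ≤ m → s₂ ≤ m → t₁ ≤ m → t₂ ≤ m → s₁ + s₂ ≡ t₁ + t₂ →
      G (q * m + s₁ ∷ q * m + s₂ ∷ R) U k ≡ G (q * m + t₁ ∷ q * m + t₂ ∷ R) U k
    pairMove q s₁ s₂ t₁ t₂ R U k s₁≤m s₂≤m t₁≤m t₂≤m eq =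
      trans (G-pair q s₁ s₂ R U k s₁≤m s₂≤m)
            (trans (cong (λ s → pairCount q s R U k) eq) (sym (G-pair q t₁ t₂ R U k t₁≤m t₂≤m)))

module SingletonBoards where

  open Counting
  open PairMoves
  open import Data.List using (List; []; _∷_; foldr)
  open import Data.List.Relation.Unary.Linked using (Linked; []; [-]; _∷_)
  import Data.List.Relation.Unary.Linked as Linked
  open import Data.Nat
    using (ℕ; zero; suc; _+_; _*_; _∸_; _/_; _%_; _≤_; _<_; _≤?_; _<?_; _≟_; NonZero; z≤n; s≤s; >-nonZero⁻¹)
  open import Data.Nat.Properties
  open import Data.Nat.DivMod using (m≡m%n+[m/n]*n; +-distrib-/-∣ˡ; m*n/n≡m; m<n⇒m/n≡0; m/n*n≤m; /-monoˡ-≤; m%n<n)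
  open import Data.Nat.Divisibility using (n∣m*n)
  open import Data.Product using (_×_; _,_)
  open import Data.Unit using (⊤; tt)
  open import Data.Bool using (if_then_else_)
  open import Data.Empty using (⊥-elim)
  open import Relation.Nullary using (yes; no; ¬_)
  open import Relation.Binary.PropositionalEquality

  Head : (ℕ → Set) → List ℕ → Set
  Head P []      = ⊤
  Head P (h ∷ _) = P h

  Head-map : ∀ {P Q : ℕ → Set} → (∀ {h} → P h → Q h) → ∀ L → Head P L → Head Q L
  Head-map f []      _ = tt
  Head-map f (h ∷ _) p = f p

  linked-cons : ∀ {R : ℕ → ℕ → Set} {a} L → Head (R a) L → Linked R L → Linked R (a ∷ L)
  linked-cons []      _ _ = [-]
  linked-cons (h ∷ _) r l = r ∷ l

  linked-head : ∀ {R : ℕ → ℕ → Set} {a} L → Linked R (a ∷ L) → Head (R a) L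
  linked-head []      _       = tt
  linked-head (h ∷ _) (r ∷ _) = r

  module Normalisation (m : ℕ) .{{_ : NonZero m}} where
    open RookNumbers m
    open PairMove m

    ⌊_⌋ : ℕ → ℕ
    ⌊ x ⌋ = floorM m x

    split-level : ∀ x → x ≡ x / m * m + x % m
    split-level x = trans (m≡m%n+[m/n]*n x m) (+-comm (x % m) _)

    level-of : ∀ q i → i < m → (q * m + i) / m ≡ q
    level-of q i i<m = trans (+-distrib-/-∣ˡ i (n∣m*n q))
                             (trans (cong₂ _+_ (m*n/n≡m q m) (m<n⇒m/n≡0 i<m)) (+-identityʳ q))

    floor-of : ∀ q i → i < m → ⌊ q * m + i ⌋ ≡ q * m
    floor-of q i i<m = cong (_* m) (level-of q i i<m)

    floor-multiple : ∀ q → ⌊ q * m ⌋ ≡ q * m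
    floor-multiple q = cong (_* m) (m*n/n≡m q m)

    floor≤ : ∀ x → ⌊ x ⌋ ≤ x
    floor≤ x = m/n*n≤m x m

    level-mono : ∀ {a b} → a ≤ b → a / m ≤ b / m
    level-mono = /-monoˡ-≤ m

    floor-mono : ∀ {a b} → a ≤ b → ⌊ a ⌋ ≤ ⌊ b ⌋
    floor-mono a≤b = *-monoˡ-≤ m (level-mono a≤b)

    floor<⇒level< : ∀ {a b} → ⌊ a ⌋ < ⌊ b ⌋ → a / m < b / m
    floor<⇒level< = *-cancelʳ-< m _ _

    level<⇒floor< : ∀ {a b} → a / m < b / m → ⌊ a ⌋ < ⌊ b ⌋
    level<⇒floor< = *-monoˡ-< m

    multiple≤⇒level≤ : ∀ q h → q * m ≤ h → q ≤ h / m
    multiple≤⇒level≤ q h le = subst (_≤ h / m) (m*n/n≡m q m) (level-mono le)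

    multiple≤⇒floor≤ : ∀ q h → q * m ≤ h → q * m ≤ ⌊ h ⌋
    multiple≤⇒floor≤ q h le = *-monoˡ-≤ m (multiple≤⇒level≤ q h le)

    -- Linked Step is the conjunction of IsFerrers and Singleton m.
    Step : ℕ → ℕ → Set
    Step a b = a ≤ b × (⌊ a ⌋ ≢ a → ⌊ a ⌋ < ⌊ b ⌋)

    step-multiple : ∀ {a b} → a ≤ b → ⌊ a ⌋ ≡ a → Step a b
    step-multiple a≤b eq = a≤b , λ ne → ⊥-elim (ne eq)

    step-level : ∀ {a b} → a ≤ b → a / m < b / m → Step a b
    step-level a≤b lt = a≤b , λ _ → level<⇒floor< lt

    step-below : ∀ q t h → t < m → suc q * m ≤ h → Step (q * m + t) h
    step-below q t h t<m le =
      <⇒≤ (<-≤-trans below le) ,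
      λ _ → subst (_< ⌊ h ⌋) (sym (floor-of q t t<m)) (<-≤-trans (m<m+n (q * m) (>-nonZero⁻¹ m))
                                                         (subst (_≤ ⌊ h ⌋) (+-comm m (q * m)) (multiple≤⇒floor≤ (suc q) h le)))
      where
      below : q * m + t < suc q * m
      below = subst (q * m + t <_) (+-comm (q * m) m) (+-monoʳ-< (q * m) t<m)

    below-next : ∀ x → x < suc (x / m) * m
    below-next x = subst₂ _<_ (sym (split-level x)) (+-comm (x / m * m) m) (+-monoʳ-< (x / m * m) (m%n<n x m))

    level<⇒< : ∀ {a b} → a / m < b / m → a < b
    level<⇒< {a} {b} lt = <-≤-trans (below-next a) (≤-trans (*-monoˡ-≤ m lt) (floor≤ b))

    same-level : ∀ x b → ¬ (x / m < b / m) → ⌊ x ⌋ ≤ b → b / m ≡ x / m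
    same-level x b ≮ ⌊x⌋≤b = ≤-antisym (≮⇒≥ ≮) (multiple≤⇒level≤ (x / m) b ⌊x⌋≤b)

    same-band : ∀ x b → ¬ (x / m < b / m) → ⌊ x ⌋ ≤ b → b ≡ x / m * m + b % m
    same-band x b ≮ ⌊x⌋≤b = trans (split-level b) (cong (λ l → l * m + b % m) (same-level x b ≮ ⌊x⌋≤b))

    record _≈G_ (A B : List ℕ) : Set where
      constructor mk≈G
      field G-eq : ∀ U k → G A U k ≡ G B U k
    open _≈G_ public

    ≈G-refl : ∀ {A} → A ≈G A
    ≈G-refl = mk≈G λ U k → refl

    ≈G-trans : ∀ {A B C} → A ≈G B → B ≈G C → A ≈G C
    ≈G-trans e₁ e₂ = mk≈G λ U k → trans (G-eq e₁ U k) (G-eq e₂ U k)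

    ≈G-cons : ∀ a {A B} → A ≈G B → (a ∷ A) ≈G (a ∷ B)
    ≈G-cons a {A} {B} e = mk≈G eq
      where
      eq : ∀ U k → G (a ∷ A) U k ≡ G (a ∷ B) U k
      eq U zero    = G-eq e U zero
      eq U (suc k) = cong₂ _+_ (G-eq e U (suc k))
                       (∑<-cong a (λ r _ → cong (if mem (r / m) U then 0 else_) (G-eq e (r / m ∷ U) k)))

    -- Inserting a column x in front of a singleton Ferrers board b ∷ R with
    -- ⌊ x ⌋ ≤ b.  If x may precede b we simply cons.  Otherwise x and b lie in
    -- the same band q·m … (q+1)·m and cells move between them (pairMove):
    -- either b fills its level q and x keeps the overflow t, or x gives up its
    -- partial level to b; the changed column is inserted into R.
    insert : ℕ → List ℕ → List ℕ
    insert x []      = x ∷ []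
    insert x (b ∷ R) with ⌊ x ⌋ ≟ x | x / m <? b / m | m ≤? x % m + b % m
    ... | yes _ | _     | _     = x ∷ b ∷ R
    ... | no _  | yes _ | _     = x ∷ b ∷ R
    ... | no _  | no _  | yes _ = x / m * m + (x % m + b % m ∸ m) ∷ insert (suc (x / m) * m) R
    ... | no _  | no _  | no _  = x / m * m ∷ insert (x / m * m + (x % m + b % m)) R

    record Inserted (x : ℕ) (L I : List ℕ) : Set where
      field
        counts : I ≈G (x ∷ L)
        linked : Linked Step I
        head   : Head (⌊ x ⌋ ≤_) I

    Insertable : List ℕ → Set
    Insertable R = ∀ y → Head (⌊ y ⌋ ≤_) R → Inserted y R (insert y R)

    insert-overflow : ∀ x b R → Linked Step (b ∷ R) → ⌊ x ⌋ ≤ b → ¬ (x / m < b / m) →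
      m ≤ x % m + b % m → Insertable R →
      Inserted x (b ∷ R) (x / m * m + (x % m + b % m ∸ m) ∷ insert (suc (x / m) * m) R)
    insert-overflow x b R lk ⌊x⌋≤b ≮ overflow rec = record
      { counts = counts
      ; linked = linked-cons (insert (suc q * m) R) headStep (Inserted.linked IH)
      ; head   = m≤m+n (q * m) t
      }
      where
      q = x / m
      t = x % m + b % m ∸ m
      t<m : t < m
      t<m = subst (t <_) (m+n∸n≡m m m) (∸-monoˡ-< (+-mono-< (m%n<n x m) (m%n<n b m)) overflow)
      b-split : b ≡ q * m + b % m
      b-split = same-band x b ≮ ⌊x⌋≤b
      -- b does not fill its level, so the columns after b start a higher band
      b-partial : ⌊ b ⌋ ≢ b
      b-partial ⌊b⌋≡b = <⇒≱ (m%n<n x m) (subst (m ≤_) (trans (cong (x % m +_) b%m≡0) (+-identityʳ _)) overflow)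
        where
        b%m≡0 : b % m ≡ 0
        b%m≡0 = +-cancelˡ-≡ (q * m) _ _ (begin
            q * m + b % m     ≡⟨ sym b-split ⟩
            b                 ≡⟨ sym ⌊b⌋≡b ⟩
            ⌊ b ⌋             ≡⟨ cong ⌊_⌋ b-split ⟩
            ⌊ q * m + b % m ⌋ ≡⟨ floor-of q (b % m) (m%n<n b m) ⟩
            q * m             ≡⟨ sym (+-identityʳ _) ⟩
            q * m + 0         ∎)
          where open ≡-Reasoning
      next-band : ∀ R → Linked Step (b ∷ R) → Head (⌊ suc q * m ⌋ ≤_) R
      next-band []      _                = tt
      next-band (c ∷ _) ((_ , part) ∷ _) =
        subst (_≤ c) (sym (floor-multiple (suc q))) (≤-trans (*-monoˡ-≤ m q<c) (floor≤ c))
        where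
        q<c : q < c / m
        q<c = subst (_< c / m) (same-level x b ≮ ⌊x⌋≤b) (floor<⇒level< (part b-partial))
      IH = rec (suc q * m) (next-band R lk)
      headStep : Head (Step (q * m + t)) (insert (suc q * m) R)
      headStep = Head-map (λ {h} le → step-below q t h t<m (subst (_≤ h) (floor-multiple (suc q)) le))
                          (insert (suc q * m) R) (Inserted.head IH)
      counts : (q * m + t ∷ insert (suc q * m) R) ≈G (x ∷ b ∷ R)
      counts = ≈G-trans (≈G-cons (q * m + t) (Inserted.counts IH)) (mk≈G λ U k → begin
          G (q * m + t ∷ suc q * m ∷ R) U k
        ≡⟨ cong (λ c → G (q * m + t ∷ c ∷ R) U k) (+-comm m (q * m)) ⟩
          G (q * m + t ∷ q * m + m ∷ R) U k
        ≡⟨ pairMove q t m (x % m) (b % m) R U k (<⇒≤ t<m) ≤-refl (<⇒≤ (m%n<n x m)) (<⇒≤ (m%n<n b m))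
                    (m∸n+n≡m overflow) ⟩
          G (q * m + x % m ∷ q * m + b % m ∷ R) U k
        ≡⟨ cong₂ (λ c d → G (c ∷ d ∷ R) U k) (sym (split-level x)) (sym b-split) ⟩
          G (x ∷ b ∷ R) U k
        ∎)
        where open ≡-Reasoning

    insert-fits : ∀ x b R → Linked Step (b ∷ R) → ⌊ x ⌋ ≤ b → ¬ (x / m < b / m) →
      x % m + b % m < m → Insertable R →
      Inserted x (b ∷ R) (x / m * m ∷ insert (x / m * m + (x % m + b % m)) R)
    insert-fits x b R lk ⌊x⌋≤b ≮ s<m rec = record
      { counts = counts
      ; linked = linked-cons (insert (q * m + s) R) headStep (Inserted.linked IH)
      ; head   = ≤-refl
      }
      where
      q = x / m
      s = x % m + b % m
      b-split : b ≡ q * m + b % m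
      b-split = same-band x b ≮ ⌊x⌋≤b
      same-band-next : ∀ R → Linked Step (b ∷ R) → Head (⌊ q * m + s ⌋ ≤_) R
      same-band-next []      _               = tt
      same-band-next (c ∷ _) ((b≤c , _) ∷ _) =
        subst (_≤ c) (sym (floor-of q s s<m)) (≤-trans (subst (q * m ≤_) (sym b-split) (m≤m+n _ _)) b≤c)
      IH = rec (q * m + s) (same-band-next R lk)
      headStep : Head (Step (q * m)) (insert (q * m + s) R)
      headStep = Head-map (λ {h} le → step-multiple (subst (_≤ h) (floor-of q s s<m) le) (floor-multiple q))
                          (insert (q * m + s) R) (Inserted.head IH)
      counts : (q * m ∷ insert (q * m + s) R) ≈G (x ∷ b ∷ R)
      counts = ≈G-trans (≈G-cons (q * m) (Inserted.counts IH)) (mk≈G λ U k → begin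
          G (q * m ∷ q * m + s ∷ R) U k
        ≡⟨ cong (λ c → G (c ∷ q * m + s ∷ R) U k) (sym (+-identityʳ (q * m))) ⟩
          G (q * m + 0 ∷ q * m + s ∷ R) U k
        ≡⟨ pairMove q 0 s (x % m) (b % m) R U k z≤n (<⇒≤ s<m) (<⇒≤ (m%n<n x m)) (<⇒≤ (m%n<n b m)) refl ⟩
          G (q * m + x % m ∷ q * m + b % m ∷ R) U k
        ≡⟨ cong₂ (λ c d → G (c ∷ d ∷ R) U k) (sym (split-level x)) (sym b-split) ⟩
          G (x ∷ b ∷ R) U k
        ∎)
        where open ≡-Reasoning

    insert-inv : ∀ x L → Linked Step L → Head (⌊ x ⌋ ≤_) L → Inserted x L (insert x L)
    insert-inv x []      _  _ = record { counts = ≈G-refl ; linked = [-] ; head = floor≤ x }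
    insert-inv x (b ∷ R) lk ⌊x⌋≤b with ⌊ x ⌋ ≟ x | x / m <? b / m | m ≤? x % m + b % m
    ... | yes ⌊x⌋≡x | _  | _ =
      record { counts = ≈G-refl ; linked = step-multiple (subst (_≤ b) ⌊x⌋≡x ⌊x⌋≤b) ⌊x⌋≡x ∷ lk
             ; head = floor≤ x }
    ... | no _ | yes lt | _ =
      record { counts = ≈G-refl ; linked = step-level (<⇒≤ (level<⇒< lt)) lt ∷ lk ; head = floor≤ x }
    ... | no _ | no ≮ | yes overflow =
      insert-overflow x b R lk ⌊x⌋≤b ≮ overflow (λ y → insert-inv y R (Linked.tail lk))
    ... | no _ | no ≮ | no fits =
      insert-fits x b R lk ⌊x⌋≤b ≮ (≰⇒> fits) (λ y → insert-inv y R (Linked.tail lk))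

    record Normalised (B N : List ℕ) : Set where
      field
        counts : N ≈G B
        linked : Linked Step N
        head   : ∀ x → Head (x ≤_) B → Head (⌊ x ⌋ ≤_) N

    normalForm : List ℕ → List ℕ
    normalForm = foldr insert []

    normalForm-inv : ∀ B → IsFerrers B → Normalised B (normalForm B)
    normalForm-inv []      _   = record { counts = ≈G-refl ; linked = [] ; head = λ _ _ → tt }
    normalForm-inv (a ∷ R) fer = record
      { counts = ≈G-trans (Inserted.counts ins) (≈G-cons a (Normalised.counts IH))
      ; linked = Inserted.linked ins
      ; head   = λ x x≤a → Head-map (λ le → ≤-trans (floor-mono x≤a) le) (insert a (normalForm R)) (Inserted.head ins)
      }
      where
      IH  = normalForm-inv R (Linked.tail fer)
      ins = insert-inv a (normalForm R) (Normalised.linked IH) (Normalised.head IH a (linked-head R fer))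

-- On a singleton Ferrers board each column offers the same number of free
-- rows, whatever the levels used by the earlier columns; hence its counts G
-- obey a recursion g with integer coefficients b − u·m.
module FactorizationTheorem where

  open Counting
  open PairMoves
  open SingletonBoards
  open import Data.Bool using (Bool; true; false; _∨_; if_then_else_; T)
  open import Data.List using (List; []; _∷_; length)
  open import Data.List.Relation.Unary.All as All using (All; []; _∷_)
  open import Data.List.Relation.Unary.Linked using (Linked; []; _∷_)
  import Data.List.Relation.Unary.Linked as Linked
  open import Data.Nat as ℕ using (ℕ; zero; suc; _/_; _%_; _<_; _≡ᵇ_; _≟_; NonZero; z<s; s<s)
  open import Data.Nat.Properties as ℕP using (≡ᵇ⇒≡; <-≤-trans; ≤-<-trans; <⇒≤)
  open import Data.Nat.DivMod using (m%n<n; m<n*o⇒m/o<n)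
  open import Data.Nat.Tactic.RingSolver using (solve-∀)
  import Data.Integer.Tactic.RingSolver as ℤSolver
  open import Data.Integer as ℤ using (ℤ; +_; _+_; _*_; _-_; 0ℤ; 1ℤ)
  import Data.Integer.Properties as ℤP
  open import Data.Product using (_×_; _,_; proj₁)
  open import Data.Unit using (⊤; tt)
  open import Relation.Nullary using (yes; no)
  open import Relation.Binary.PropositionalEquality

  ∑<-zero-or : ∀ n (f : ℕ → ℕ) (c : ℕ → Bool) (z : ℤ) →
    (∀ i → i < n → + f i ≡ (if c i then 0ℤ else z)) →
    + ∑< n f ≡ + ∑< n (λ i → if c i then 0 else 1) * z
  ∑<-zero-or zero    f c z eq = refl
  ∑<-zero-or (suc n) f c z eq = begin
      + (f 0 ℕ.+ ∑< n (λ i → f (suc i)))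
    ≡⟨ ℤP.pos-+ (f 0) _ ⟩
      + f 0 + + ∑< n (λ i → f (suc i))
    ≡⟨ cong₂ _+_ (eq 0 z<s)
                 (∑<-zero-or n (λ i → f (suc i)) (λ i → c (suc i)) z (λ i i<n → eq (suc i) (s<s i<n))) ⟩
      (if c 0 then 0ℤ else z) + + N * z
    ≡⟨ first (c 0) ⟩
      + ((if c 0 then 0 else 1) ℕ.+ N) * z
    ∎
    where
    open ≡-Reasoning
    N = ∑< n (λ i → if c (suc i) then 0 else 1)
    first : ∀ b → (if b then 0ℤ else z) + + N * z ≡ + ((if b then 0 else 1) ℕ.+ N) * z
    first true  = ℤP.+-identityˡ _
    first false = trans (cong (_+ + N * z) (sym (ℤP.*-identityˡ z)))
                        (trans (sym (ℤP.*-distribʳ-+ z 1ℤ (+ N))) (cong (_* z) (sym (ℤP.pos-+ 1 N))))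

  ℕ-difference : ∀ {a b c} → a ℕ.+ c ≡ b → + a ≡ + b - + c
  ℕ-difference {a} {b} {c} eq = begin
      + a
    ≡⟨ sym (cancel (+ a) (+ c)) ⟩
      + a + + c - + c
    ≡⟨ cong (_- + c) (trans (sym (ℤP.pos-+ a c)) (cong +_ eq)) ⟩
      + b - + c
    ∎
    where
    open ≡-Reasoning
    cancel : ∀ x y → x + y - y ≡ x
    cancel = ℤSolver.solve-∀

  Nodup : List ℕ → Set
  Nodup []      = ⊤
  Nodup (x ∷ U) = mem x U ≡ false × Nodup U

  mem-above : ∀ q U → All (_< q) U → mem q U ≡ false
  mem-above q []      []         = refl
  mem-above q (x ∷ U) (x<q ∷ U<q) = cong₂ _∨_ (<⇒≡ᵇ-false x<q) (mem-above q U U<q)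
    where
    <⇒≡ᵇ-false : ∀ {x q} → x < q → (x ≡ᵇ q) ≡ false
    <⇒≡ᵇ-false {zero}  {suc q} _          = refl
    <⇒≡ᵇ-false {suc x} {suc q} (s<s x<q) = <⇒≡ᵇ-false x<q

  ∑<-single : ∀ q x → x < q → ∑< q (λ l → if x ≡ᵇ l then 1 else 0) ≡ 1
  ∑<-single (suc q) zero    _         = cong suc (∑<-zero q)
  ∑<-single (suc q) (suc x) (s<s x<q) = ∑<-single q x x<q

  free-levels : ∀ q U → Nodup U → All (_< q) U → ∑< q (λ l → if mem l U then 0 else 1) ℕ.+ length U ≡ q
  free-levels q []      _           []          = trans (ℕP.+-identityʳ _) (trans (∑<-const q 1) (ℕP.*-identityʳ q))
  free-levels q (x ∷ U) (x∉U , nodup) (x<q ∷ U<q) = begin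
      ∑< q (free (x ∷ U)) ℕ.+ suc (length U)
    ≡⟨ cong (λ o → ∑< q (free (x ∷ U)) ℕ.+ (o ℕ.+ length U)) (sym (∑<-single q x x<q)) ⟩
      ∑< q (free (x ∷ U)) ℕ.+ (∑< q (λ l → if x ≡ᵇ l then 1 else 0) ℕ.+ length U)
    ≡⟨ sym (ℕP.+-assoc (∑< q (free (x ∷ U))) _ _) ⟩
      ∑< q (free (x ∷ U)) ℕ.+ ∑< q (λ l → if x ≡ᵇ l then 1 else 0) ℕ.+ length U
    ≡⟨ cong (ℕ._+ length U) (sym (∑<-+ q _ _)) ⟩
      ∑< q (λ l → free (x ∷ U) l ℕ.+ (if x ≡ᵇ l then 1 else 0)) ℕ.+ length U
    ≡⟨ cong (ℕ._+ length U) (∑<-cong q (λ l _ → split l)) ⟩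
      ∑< q (free U) ℕ.+ length U
    ≡⟨ free-levels q U nodup U<q ⟩
      q
    ∎
    where
    open ≡-Reasoning
    free : List ℕ → ℕ → ℕ
    free V l = if mem l V then 0 else 1
    split : ∀ l → free (x ∷ U) l ℕ.+ (if x ≡ᵇ l then 1 else 0) ≡ free U l
    split l with x ≡ᵇ l in x≡ᵇl
    ... | false = ℕP.+-identityʳ _
    ... | true  rewrite sym (≡ᵇ⇒≡ x l (subst T (sym x≡ᵇl) tt)) | x∉U = refl

  module Factorization (m : ℕ) .{{_ : NonZero m}} where
    open RookNumbers m
    open PairMove m
    open Normalisation m

    free-rows : ∀ b U → Nodup U → All (_< b / m) U →
      ∑< b (λ r → if mem (r / m) U then 0 else 1) ℕ.+ length U ℕ.* m ≡ b
    free-rows b U nodup U<q = begin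
        ∑< b (λ r → F (r / m)) ℕ.+ length U ℕ.* m
      ≡⟨ cong (λ n → ∑< n (λ r → F (r / m)) ℕ.+ length U ℕ.* m) (split-level b) ⟩
        ∑< (q ℕ.* m ℕ.+ s) (λ r → F (r / m)) ℕ.+ length U ℕ.* m
      ≡⟨ cong (ℕ._+ length U ℕ.* m) (levelSum q s F (<⇒≤ (m%n<n b m))) ⟩
        m ℕ.* ∑< q F ℕ.+ s ℕ.* F q ℕ.+ length U ℕ.* m
      ≡⟨ cong (λ z → m ℕ.* ∑< q F ℕ.+ s ℕ.* (if z then 0 else 1) ℕ.+ length U ℕ.* m) (mem-above q U U<q) ⟩
        m ℕ.* ∑< q F ℕ.+ s ℕ.* 1 ℕ.+ length U ℕ.* m
      ≡⟨ collect m (∑< q F) s (length U) ⟩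
        (∑< q F ℕ.+ length U) ℕ.* m ℕ.+ s
      ≡⟨ cong (λ z → z ℕ.* m ℕ.+ s) (free-levels q U nodup U<q) ⟩
        q ℕ.* m ℕ.+ s
      ≡⟨ sym (split-level b) ⟩
        b
      ∎
      where
      open ≡-Reasoning
      q = b / m
      s = b % m
      F : ℕ → ℕ
      F l = if mem l U then 0 else 1
      collect : ∀ m a s u → m ℕ.* a ℕ.+ s ℕ.* 1 ℕ.+ u ℕ.* m ≡ (a ℕ.+ u) ℕ.* m ℕ.+ s
      collect = solve-∀

    g : List ℕ → ℕ → ℕ → ℤ
    g []       u zero    = 1ℤ
    g []       u (suc k) = 0ℤ
    g (b ∷ bs) u zero    = g bs u zero
    g (b ∷ bs) u (suc k) = g bs u (suc k) + (+ b - + (u ℕ.* m)) * g bs (suc u) k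

    Below : List ℕ → List ℕ → Set
    Below []      U = ⊤
    Below (b ∷ _) U = All (_< b / m) U

    row-level< : ∀ {b c} r → Step b c → r < b → r / m < c / m
    row-level< {b} {c} r (b≤c , part) r<b with ⌊ b ⌋ ≟ b
    ... | yes ⌊b⌋≡b = <-≤-trans (m<n*o⇒m/o<n (subst (r <_) (sym ⌊b⌋≡b) r<b)) (level-mono b≤c)
    ... | no  ⌊b⌋≢b = ≤-<-trans (level-mono (<⇒≤ r<b)) (floor<⇒level< (part ⌊b⌋≢b))

    below-tail : ∀ {b} bs {U} → Linked Step (b ∷ bs) → All (_< b / m) U → Below bs U
    below-tail []      _               _   = tt
    below-tail (c ∷ _) ((b≤c , _) ∷ _) U<b = All.map (λ l<b → <-≤-trans l<b (level-mono b≤c)) U<b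

    below-row : ∀ {b} bs {U} r → r < b → Linked Step (b ∷ bs) → All (_< b / m) U → Below bs (r / m ∷ U)
    below-row []      r r<b _        _   = tt
    below-row (c ∷ _) r r<b (st ∷ _) U<b =
      row-level< r st r<b ∷ All.map (λ l<b → <-≤-trans l<b (level-mono (proj₁ st))) U<b

    factorization : ∀ L U k → Linked Step L → Nodup U → Below L U → + G L U k ≡ g L (length U) k
    factorization []       U zero    _  _     _   = refl
    factorization []       U (suc k) _  _     _   = refl
    factorization (b ∷ bs) U zero    lk nodup U<b =
      factorization bs U zero (Linked.tail lk) nodup (below-tail bs lk U<b)
    factorization (b ∷ bs) U (suc k) lk nodup U<b = begin
        + (G bs U (suc k) ℕ.+ ∑< b f)
      ≡⟨ ℤP.pos-+ (G bs U (suc k)) (∑< b f) ⟩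
        + G bs U (suc k) + + ∑< b f
      ≡⟨ cong₂ _+_ (factorization bs U (suc k) (Linked.tail lk) nodup (below-tail bs lk U<b))
                   (∑<-zero-or b f (λ r → mem (r / m) U) _ row) ⟩
        g bs u (suc k) + + ∑< b (λ r → if mem (r / m) U then 0 else 1) * g bs (suc u) k
      ≡⟨ cong (λ z → g bs u (suc k) + z * g bs (suc u) k) free ⟩
        g bs u (suc k) + (+ b - + (u ℕ.* m)) * g bs (suc u) k
      ∎
      where
      open ≡-Reasoning
      u = length U
      f : ℕ → ℕ
      f r = if mem (r / m) U then 0 else G bs (r / m ∷ U) k
      row : ∀ r → r < b → + f r ≡ (if mem (r / m) U then 0ℤ else g bs (suc u) k)
      row r r<b with mem (r / m) U in r∉U
      ... | true  = refl
      ... | false = factorization bs (r / m ∷ U) k (Linked.tail lk) (r∉U , nodup) (below-row bs r r<b lk U<b)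
      free : + ∑< b (λ r → if mem (r / m) U then 0 else 1) ≡ + b - + (u ℕ.* m)
      free = ℕ-difference (free-rows b U nodup U<b)

    rook-g : ∀ L k → Linked Step L → + rookNumber k m L ≡ g L 0 k
    rook-g []      k lk = trans (cong +_ (rookNumber-G k [])) (factorization [] [] k lk tt tt)
    rook-g (b ∷ L) k lk = trans (cong +_ (rookNumber-G k (b ∷ L))) (factorization (b ∷ L) [] k lk tt [])

module Polynomial (m : ℕ) .{{_ : NonZero m}} where

  open SingletonBoards
  open FactorizationTheorem
  open import Data.List using (List; []; _∷_; length)
  open import Data.List.Relation.Unary.Linked using (Linked; []; _∷_)
  import Data.List.Relation.Unary.Linked as Linked
  open import Data.Nat as ℕ using (ℕ; zero; suc; _≤_; _<_; NonZero; z≤n; s≤s)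
  import Data.Nat.Properties as ℕP
  open import Data.Integer as ℤ using (ℤ; +_; _+_; _*_; _-_; -_; 0ℤ; 1ℤ)
  import Data.Integer.Properties as ℤP
  open import Data.Integer.Tactic.RingSolver using (solve-∀)
  open import Data.Product using (_,_)
  open import Data.Sum using (inj₁; inj₂)
  open import Data.Empty using (⊥-elim)
  open import Relation.Binary.PropositionalEquality
  open import Relation.Binary.Definitions using (tri<; tri≈; tri>)
  open import Algebra.Bundles using (AbelianGroup)
  open import Algebra.Properties.Group (AbelianGroup.group ℤP.+-0-abelianGroup) using (∙-cancelʳ)
  open Factorization m

  μ : ℕ → ℤ
  μ v = + (v ℕ.* m)

  μ-+ : ∀ u v → μ (u ℕ.+ v) ≡ μ u + μ v
  μ-+ u v = trans (cong +_ (ℕP.*-distribʳ-+ m u v)) (ℤP.pos-+ (u ℕ.* m) (v ℕ.* m))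

  μ-suc : ∀ v → μ (suc v) ≡ + m + μ v
  μ-suc v = ℤP.pos-+ m (v ℕ.* m)

  P : List ℕ → ℤ → ℤ
  P []       Y = 1ℤ
  P (b ∷ bs) Y = (Y + + b) * P bs (Y - + m)

  -- Horner form of Σ_{k ≤ n} α k · (Y − v·m)(Y − (v+1)·m)⋯(Y − (v+n−k−1)·m),
  -- the expansion with coefficients α in the m-falling factorial basis.
  H : (ℕ → ℤ) → ℕ → ℕ → ℤ → ℤ
  H α v zero    Y = α 0
  H α v (suc n) Y = (Y - μ v) * H α (suc v) n Y + α (suc n)

  H-cong : ∀ {α β} v n Y → (∀ k → α k ≡ β k) → H α v n Y ≡ H β v n Y
  H-cong v zero    Y eq = eq 0
  H-cong v (suc n) Y eq = cong₂ (λ x y → (Y - μ v) * x + y) (H-cong (suc v) n Y eq) (eq (suc n))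

  push : (ℕ → ℤ) → ℤ → (ℕ → ℤ) → ℕ → ℤ
  push α c β zero    = α zero
  push α c β (suc k) = α (suc k) + c * β k

  H-push : ∀ α c β v n Y → H (push α c β) v (suc n) Y ≡ H α v (suc n) Y + c * H β v n Y
  H-push α c β v zero    Y = sym (ℤP.+-assoc ((Y - μ v) * α 0) (α 1) (c * β 0))
  H-push α c β v (suc n) Y = begin
      (Y - μ v) * H (push α c β) (suc v) (suc n) Y + (α (suc (suc n)) + c * β (suc n))
    ≡⟨ cong (λ x → (Y - μ v) * x + (α (suc (suc n)) + c * β (suc n))) (H-push α c β (suc v) n Y) ⟩
      (Y - μ v) * (H α (suc v) (suc n) Y + c * H β (suc v) n Y) + (α (suc (suc n)) + c * β (suc n))
    ≡⟨ collect (Y - μ v) (H α (suc v) (suc n) Y) c (H β (suc v) n Y) (α (suc (suc n))) (β (suc n)) ⟩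
      (Y - μ v) * H α (suc v) (suc n) Y + α (suc (suc n)) + c * ((Y - μ v) * H β (suc v) n Y + β (suc n))
    ∎
    where
    open ≡-Reasoning
    collect : ∀ y a c b x z → y * (a + c * b) + (x + c * z) ≡ y * a + x + c * (y * b + z)
    collect = solve-∀

  g-beyond : ∀ A u k → length A < k → g A u k ≡ 0ℤ
  g-beyond []       u (suc k) _         = refl
  g-beyond (b ∷ bs) u (suc k) (s≤s lt) =
    trans (cong₂ _+_ (g-beyond bs u (suc k) (ℕP.m<n⇒m<1+n lt))
                     (trans (cong ((+ b - μ u) *_) (g-beyond bs (suc u) k lt)) (ℤP.*-zeroʳ (+ b - μ u))))
          (ℤP.+-identityʳ 0ℤ)

  H-g : ∀ A u v Y → H (g A u) v (length A) Y ≡ P A (Y - μ (u ℕ.+ v))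
  H-g []       u v Y = refl
  H-g (b ∷ bs) u v Y = begin
      H (g (b ∷ bs) u) v (suc n) Y
    ≡⟨ H-cong v (suc n) Y coefficients ⟩
      H (push (g bs u) (+ b - μ u) (g bs (suc u))) v (suc n) Y
    ≡⟨ H-push (g bs u) (+ b - μ u) (g bs (suc u)) v n Y ⟩
      (Y - μ v) * H (g bs u) (suc v) n Y + g bs u (suc n) + (+ b - μ u) * H (g bs (suc u)) v n Y
    ≡⟨ cong₂ (λ x y → (Y - μ v) * H (g bs u) (suc v) n Y + x + (+ b - μ u) * y)
             (g-beyond bs u (suc n) (ℕP.n<1+n n)) (H-g bs (suc u) v Y) ⟩
      (Y - μ v) * H (g bs u) (suc v) n Y + 0ℤ + (+ b - μ u) * P bs (Y - μ (suc u ℕ.+ v))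
    ≡⟨ cong (λ x → (Y - μ v) * x + 0ℤ + (+ b - μ u) * P bs (Y - μ (suc u ℕ.+ v))) (H-g bs u (suc v) Y) ⟩
      (Y - μ v) * P bs (Y - μ (u ℕ.+ suc v)) + 0ℤ + (+ b - μ u) * P bs (Y - μ (suc u ℕ.+ v))
    ≡⟨ cong₂ (λ x y → (Y - μ v) * P bs x + 0ℤ + (+ b - μ u) * P bs y)
             (trans (cong (λ w → Y - μ w) (ℕP.+-suc u v)) shift) shift ⟩
      (Y - μ v) * P bs W + 0ℤ + (+ b - μ u) * P bs W
    ≡⟨ collect Y (μ u) (μ v) (+ b) (P bs W) ⟩
      (Y - (μ u + μ v) + + b) * P bs W
    ≡⟨ cong (λ x → (Y - x + + b) * P bs (Y - x - + m)) (sym (μ-+ u v)) ⟩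
      P (b ∷ bs) (Y - μ (u ℕ.+ v))
    ∎
    where
    open ≡-Reasoning
    n = length bs
    W = Y - (μ u + μ v) - + m
    coefficients : ∀ k → g (b ∷ bs) u k ≡ push (g bs u) (+ b - μ u) (g bs (suc u)) k
    coefficients zero    = refl
    coefficients (suc k) = refl
    shift : Y - μ (suc (u ℕ.+ v)) ≡ W
    shift = trans (cong (λ x → Y - x) (trans (μ-suc (u ℕ.+ v)) (cong (_+_ (+ m)) (μ-+ u v))))
                  (regroup Y (+ m) (μ u) (μ v))
      where
      regroup : ∀ y m a b → y - (m + (a + b)) ≡ y - (a + b) - m
      regroup = solve-∀
    collect : ∀ y a b c p → (y - b) * p + 0ℤ + (c - a) * p ≡ (y - (a + b) + c) * p
    collect = solve-∀

  -- At Y = v·m the first factor of H vanishes, leaving the top coefficient.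
  H-at-base : ∀ γ v n → H γ v (suc n) (μ (v ℕ.+ 0)) ≡ γ (suc n)
  H-at-base γ v n = begin
      (μ (v ℕ.+ 0) - μ v) * H γ (suc v) n Y + γ (suc n)
    ≡⟨ cong (λ x → (μ x - μ v) * H γ (suc v) n Y + γ (suc n)) (ℕP.+-identityʳ v) ⟩
      (μ v - μ v) * H γ (suc v) n Y + γ (suc n)
    ≡⟨ cong (λ x → x * H γ (suc v) n Y + γ (suc n)) (ℤP.+-inverseʳ (μ v)) ⟩
      0ℤ * H γ (suc v) n Y + γ (suc n)
    ≡⟨ ℤP.+-identityˡ (γ (suc n)) ⟩
      γ (suc n)
    ∎
    where
    open ≡-Reasoning
    Y = μ (v ℕ.+ 0)

  H-top : ∀ n v α β → H α v (suc n) (μ (v ℕ.+ 0)) ≡ H β v (suc n) (μ (v ℕ.+ 0)) → α (suc n) ≡ β (suc n)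
  H-top n v α β eq = trans (sym (H-at-base α v n)) (trans eq (H-at-base β v n))

  H-above-base : ∀ γ v n t →
    H γ v (suc n) (μ (v ℕ.+ suc t)) ≡ + (suc t ℕ.* m) * H γ (suc v) n (μ (suc v ℕ.+ t)) + γ (suc n)
  H-above-base γ v n t = cong₂ (λ x Y → x * H γ (suc v) n Y + γ (suc n)) first-factor (cong μ (ℕP.+-suc v t))
    where
    cancel : ∀ a b → a + b - a ≡ b
    cancel = solve-∀
    first-factor : μ (v ℕ.+ suc t) - μ v ≡ + (suc t ℕ.* m)
    first-factor = trans (cong (_- μ v) (μ-+ v (suc t))) (cancel (μ v) (+ (suc t ℕ.* m)))

  -- Hence the basis is triangular at the points v·m, (v+1)·m, …: the values
  -- of H there determine the coefficients.
  H-triangular : ∀ n v α β → (∀ t → H α v n (μ (v ℕ.+ t)) ≡ H β v n (μ (v ℕ.+ t))) →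
    ∀ k → k ≤ n → α k ≡ β k
  H-triangular zero    v α β eq .zero z≤n = eq 0
  H-triangular (suc n) v α β eq k k≤ with ℕP.m≤n⇒m<n∨m≡n k≤
  ... | inj₂ refl      = H-top n v α β (eq 0)
  ... | inj₁ (s≤s k≤n) = H-triangular n (suc v) α β lower k k≤n
    where
    lower : ∀ t → H α (suc v) n (μ (suc v ℕ.+ t)) ≡ H β (suc v) n (μ (suc v ℕ.+ t))
    lower t = ℤP.*-cancelˡ-≡ (+ (suc t ℕ.* m)) _ _ {{ℕP.m*n≢0 (suc t) m}}
      (∙-cancelʳ (α (suc n)) _ _
        (trans (sym (H-above-base α v n t))
          (trans (eq (suc t)) (trans (H-above-base β v n t)
            (cong (_+_ (+ (suc t ℕ.* m) * H β (suc v) n (μ (suc v ℕ.+ t)))) (sym (H-top n v α β (eq 0))))))))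

  P-as-H : ∀ A Y → P A Y ≡ H (g A 0) 0 (length A) Y
  P-as-H A Y = sym (trans (H-g A 0 0 Y) (cong (P A) (ℤP.+-identityʳ Y)))

  g⇒P : ∀ A B → length A ≡ length B → (∀ k → g A 0 k ≡ g B 0 k) → ∀ Y → P A Y ≡ P B Y
  g⇒P A B len eq Y = begin
      P A Y                          ≡⟨ P-as-H A Y ⟩
      H (g A 0) 0 (length A) Y       ≡⟨ cong (λ n → H (g A 0) 0 n Y) len ⟩
      H (g A 0) 0 (length B) Y       ≡⟨ H-cong 0 (length B) Y eq ⟩
      H (g B 0) 0 (length B) Y       ≡⟨ sym (P-as-H B Y) ⟩
      P B Y                          ∎
    where open ≡-Reasoning

  P⇒g : ∀ A B → length A ≡ length B → (∀ t → P A (μ t) ≡ P B (μ t)) → ∀ k → g A 0 k ≡ g B 0 k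
  P⇒g A B len eq k with ℕP.≤-<-connex k (length A)
  ... | inj₁ k≤n = H-triangular (length A) 0 (g A 0) (g B 0) values k k≤n
    where
    values : ∀ t → H (g A 0) 0 (length A) (μ t) ≡ H (g B 0) 0 (length A) (μ t)
    values t = trans (sym (P-as-H A (μ t)))
                     (trans (eq t) (trans (P-as-H B (μ t)) (cong (λ n → H (g B 0) 0 n (μ t)) (sym len))))
  ... | inj₂ n<k = trans (g-beyond A 0 k n<k) (sym (g-beyond B 0 k (subst (ℕ._< k) len n<k)))

  P-extend : ∀ A B → length A ≡ length B → (∀ t → P A (μ t) ≡ P B (μ t)) → ∀ Y → P A Y ≡ P B Y
  P-extend A B len eq = g⇒P A B len (P⇒g A B len eq)

  Rst : ℕ → ℕ → Set
  Rst a b = b ≤ a ℕ.+ m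

  P-root : ∀ d D → P (d ∷ D) (- + d) ≡ 0ℤ
  P-root d D = trans (cong (_* P D (- + d - + m)) (ℤP.+-inverseˡ (+ d))) (ℤP.*-zeroˡ (P D (- + d - + m)))

  P-no-root : ∀ C X → Linked Rst C → Head (ℕ._< X) C → P C (- + X) ≢ 0ℤ
  P-no-root []      X _   _   ()
  P-no-root (c ∷ C) X rst c<X eq with ℤP.i*j≡0⇒i≡0∨j≡0 (- + X + + c) eq
  ... | inj₁ factor≡0 = ℕP.<-irrefl (ℤP.+-injective c≡X) c<X
    where
    c≡X : + c ≡ + X
    c≡X = trans (solve (+ c) (+ X)) (trans (cong (_+ + X) factor≡0) (ℤP.+-identityˡ (+ X)))
      where
      solve : ∀ c x → c ≡ (- x + c) + x
      solve = solve-∀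
  ... | inj₂ rest≡0 = P-no-root C (X ℕ.+ m) (Linked.tail rst)
                        (Head-map (λ c′≤c+m → ℕP.≤-<-trans c′≤c+m (ℕP.+-monoˡ-< m c<X)) C (linked-head C rst))
                        (trans (cong (P C) shift) rest≡0)
    where
    shift : - + (X ℕ.+ m) ≡ - + X - + m
    shift = trans (cong -_ (ℤP.pos-+ X m)) (ℤP.neg-distrib-+ (+ X) (+ m))

  restricted-unique : ∀ C D → length C ≡ length D → Linked Rst C → Linked Rst D →
    (∀ Y → P C Y ≡ P D Y) → C ≡ D
  restricted-unique []      []      _   _    _    _  = refl
  restricted-unique (c ∷ C) (d ∷ D) len rstC rstD eq = cong₂ _∷_ c≡d tails
    where
    c≡d : c ≡ d
    c≡d with ℕP.<-cmp c d
    ... | tri≈ _ c≡d _ = c≡d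
    ... | tri< c<d _ _ = ⊥-elim (P-no-root (c ∷ C) d rstC c<d (trans (eq (- + d)) (P-root d D)))
    ... | tri> _ _ d<c = ⊥-elim (P-no-root (d ∷ D) c rstD d<c (trans (sym (eq (- + c))) (P-root c C)))
    len′ : length C ≡ length D
    len′ = ℕP.suc-injective len
    -- at Y = (t+1)·m the common first factor Y + c is non-zero
    atPoints : ∀ t → P C (μ t) ≡ P D (μ t)
    atPoints t = subst (λ Y → P C Y ≡ P D Y) back
      (ℤP.*-cancelˡ-≡ (+ (suc t ℕ.* m ℕ.+ c)) _ _ {{nonZero}}
        (subst (λ z → z * P C (μ (suc t) - + m) ≡ z * P D (μ (suc t) - + m)) (sym (ℤP.pos-+ (suc t ℕ.* m) c))
          (trans (eq (μ (suc t))) (cong (λ x → (μ (suc t) + + x) * P D (μ (suc t) - + m)) (sym c≡d)))))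
      where
      nonZero : ℕ.NonZero (suc t ℕ.* m ℕ.+ c)
      nonZero = ℕ.>-nonZero (ℕP.<-≤-trans (ℕ.>-nonZero⁻¹ m)
                                          (ℕP.≤-trans (ℕP.m≤m+n m (t ℕ.* m)) (ℕP.m≤m+n _ c)))
      back : μ (suc t) - + m ≡ μ t
      back = trans (cong (_- + m) (μ-suc t)) (cancel (+ m) (μ t))
        where
        cancel : ∀ a b → a + b - a ≡ b
        cancel = solve-∀
    tails : C ≡ D
    tails = restricted-unique C D len′ (Linked.tail rstC) (Linked.tail rstD) (P-extend C D len′ atPoints)

-- Settling the columns of a singleton Ferrers board, one at a time, onto an
-- m-restricted singleton Ferrers board kept in reverse order.
module Settling (m : ℕ) .{{_ : NonZero m}} where

  open PairMoves
  open SingletonBoards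
  open import Data.List using (List; []; _∷_; _++_; length)
  import Data.List.Properties as ListP
  open import Data.List.Relation.Unary.Linked using (Linked; []; [-]; _∷_)
  import Data.List.Relation.Unary.Linked as Linked
  open import Data.Nat using (ℕ; suc; _+_; _*_; _∸_; _/_; _≤_; _<_; _≤?_; _≟_; NonZero; z≤n; s≤s)
  open import Data.Nat.Properties
  open import Data.Nat.DivMod using (0/n≡0)
  open import Data.Product using (_×_; _,_)
  open import Data.Sum using (inj₁; inj₂)
  open import Data.Empty using (⊥-elim)
  open import Data.Unit using (⊤; tt)
  open import Function using (flip)
  open import Relation.Nullary using (yes; no)
  open import Relation.Binary.PropositionalEquality
  open PairMove m
  open Normalisation m
  open Polynomial m

  -- Linked StepR means restricted singleton Ferrers.
  StepR : ℕ → ℕ → Set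
  StepR a b = Step a b × Rst a b

  step-from-0 : ∀ x → Step 0 x
  step-from-0 x = step-multiple z≤n (cong (_* m) (0/n≡0 m))

  step-weaken : ∀ {h x x′} → h ≤ x → Step x x′ → Step h x′
  step-weaken {h} {x} {x′} h≤x (x≤x′ , x-partial) = ≤-trans h≤x x≤x′ , h-partial
    where
    h-partial : ⌊ h ⌋ ≢ h → ⌊ h ⌋ < ⌊ x′ ⌋
    h-partial ⌊h⌋≢h with m≤n⇒m<n∨m≡n (level-mono h≤x)
    ... | inj₁ lt   = level<⇒floor< (<-≤-trans lt (level-mono x≤x′))
    ... | inj₂ same = subst (_< ⌊ x′ ⌋) (cong (_* m) (sym same)) (x-partial x-partial′)
      where
      -- if x filled its level then so would h
      x-partial′ : ⌊ x ⌋ ≢ x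
      x-partial′ ⌊x⌋≡x = ⌊h⌋≢h (≤-antisym (floor≤ h)
        (≤-trans h≤x (subst (_≤ ⌊ h ⌋) ⌊x⌋≡x (≤-reflexive (cong (_* m) (sym same))))))

  step-raise : ∀ {z y y′} → Step z y → y ≤ y′ → Step z y′
  step-raise (z≤y , z-partial) y≤y′ = ≤-trans z≤y y≤y′ , λ ne → <-≤-trans (z-partial ne) (floor-mono y≤y′)

  step-shift : ∀ {z y} → Step z y → Step (z + m) (y + m)
  step-shift {z} {y} (z≤y , z-partial) = +-monoˡ-≤ m z≤y , shifted
    where
    shifted : ⌊ z + m ⌋ ≢ z + m → ⌊ z + m ⌋ < ⌊ y + m ⌋
    shifted ne = level<⇒floor< (subst₂ _<_ (sym (next-level z)) (sym (next-level y))
                                         (s≤s (floor<⇒level< (z-partial z-partial′))))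
      where
      z-partial′ : ⌊ z ⌋ ≢ z
      z-partial′ eq = ne (trans (cong (_* m) (next-level z)) (trans (+-comm m (z / m * m)) (cong (_+ m) eq)))

  step-into-gap : ∀ {z y h} → Step z y → y < h → h ≤ z + m → Step h (y + m)
  step-into-gap {z} {y} {h} (z≤y , z-partial) y<h h≤z+m = h≤y+m , h-partial
    where
    h≤y+m : h ≤ y + m
    h≤y+m = ≤-trans h≤z+m (+-monoˡ-≤ m z≤y)
    h-partial : ⌊ h ⌋ ≢ h → ⌊ h ⌋ < ⌊ y + m ⌋
    h-partial ⌊h⌋≢h = level<⇒floor< (subst (h / m <_) (sym (next-level y)) (s≤s h-level≤))
      where
      h-level≤ : h / m ≤ y / m
      h-level≤ with h / m ≤? y / m
      ... | yes le = le
      ... | no  gt = ⊥-elim (⌊h⌋≢h (≤-antisym (floor≤ h) h≤⌊h⌋))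
        where
        -- otherwise h lies one level above y, z on the level of y, and z fills it
        h-level : h / m ≡ suc (y / m)
        h-level = ≤-antisym (subst (h / m ≤_) (next-level y) (level-mono h≤y+m)) (≰⇒> gt)
        z-level : z / m ≡ y / m
        z-level = ≤-antisym (level-mono z≤y)
                            (≤-pred (subst₂ _≤_ h-level (next-level z) (level-mono h≤z+m)))
        z-full : ⌊ z ⌋ ≡ z
        z-full with ⌊ z ⌋ ≟ z
        ... | yes eq = eq
        ... | no  ne = ⊥-elim (<-irrefl z-level (floor<⇒level< (z-partial ne)))
        h≤⌊h⌋ : h ≤ ⌊ h ⌋
        h≤⌊h⌋ = begin
          h                  ≤⟨ h≤z+m ⟩
          z + m              ≡⟨ cong (_+ m) (sym z-full) ⟩
          z / m * m + m      ≡⟨ +-comm (z / m * m) m ⟩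
          suc (z / m) * m    ≡⟨ cong (λ l → suc l * m) z-level ⟩
          suc (y / m) * m    ≡⟨ cong (_* m) (sym h-level) ⟩
          ⌊ h ⌋              ∎
          where open ≤-Reasoning

  -- Settled rc: rc read backwards, after an empty column, is a restricted
  -- singleton Ferrers board.  A column x too high to follow the last column y
  -- (x > y + m) is exchanged for y + m, and x − m is settled further down.
  Settled : List ℕ → Set
  Settled rc = Linked (flip StepR) (rc ++ 0 ∷ [])

  settle : ℕ → List ℕ → List ℕ
  settle x []       = x ∷ []
  settle x (y ∷ ys) with x ≤? y + m
  ... | yes _ = x ∷ y ∷ ys
  ... | no  _ = y + m ∷ settle (x ∸ m) ys

  settle-length : ∀ x rc → length (settle x rc) ≡ suc (length rc)
  settle-length x []       = refl
  settle-length x (y ∷ ys) with x ≤? y + m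
  ... | yes _ = refl
  ... | no  _ = cong suc (settle-length (x ∸ m) ys)

  HeadCases : (ℕ → Set) → ℕ → List ℕ → Set
  HeadCases Q x []      = Q x
  HeadCases Q x (y ∷ _) = (x ≤ y + m → Q x) × (y + m < x → Q (y + m))

  settle-head : ∀ Q x rc s → HeadCases Q x rc → Head Q (settle x rc ++ s)
  settle-head Q x []       s q                    = q
  settle-head Q x (y ∷ ys) s (q-stay , q-exchange) with x ≤? y + m
  ... | yes x≤y+m = q-stay x≤y+m
  ... | no  x≰y+m = q-exchange (≰⇒> x≰y+m)

  -- In the exchange case x − m lies strictly above y, which
  -- makes y + m a valid successor of the last column of settle (x − m) ys.
  settle-good : ∀ x rc → Settled rc → x ≤ length rc * m → Head (λ h → Step h x) rc → Settled (settle x rc)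
  settle-good x []       _    room _    = (step-from-0 x , ≤-trans room z≤n) ∷ [-]
  settle-good x (y ∷ ys) good room step with x ≤? y + m
  ... | yes x≤y+m = (step , x≤y+m) ∷ good
  ... | no  x≰y+m = linked-cons (settle (x ∸ m) ys ++ 0 ∷ []) (settle-head _ (x ∸ m) ys (0 ∷ []) (cases ys good room))
                                (settle-good (x ∸ m) ys (Linked.tail good) room′ (steps ys good))
    where
    y+m<x : y + m < x
    y+m<x = ≰⇒> x≰y+m
    y<x∸m : y < x ∸ m
    y<x∸m = subst (_< x ∸ m) (m+n∸n≡m y m) (∸-monoˡ-< y+m<x (m≤n+m m y))
    room′ : x ∸ m ≤ length ys * m
    room′ = subst (x ∸ m ≤_) (m+n∸m≡n m (length ys * m)) (∸-monoˡ-≤ m room)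
    steps : ∀ ys → Settled (y ∷ ys) → Head (λ h → Step h (x ∸ m)) ys
    steps []      _              = tt
    steps (z ∷ _) ((zy , _) ∷ _) = step-raise zy (<⇒≤ y<x∸m)
    cases : ∀ ys → Settled (y ∷ ys) → x ≤ length (y ∷ ys) * m → HeadCases (λ h → StepR h (y + m)) (x ∸ m) ys
    cases []      _                   room =
      ⊥-elim (<⇒≱ y+m<x (≤-trans (subst (x ≤_) (+-identityʳ m) room) (m≤n+m m y)))
    cases (z ∷ _) ((zy , y≤z+m) ∷ _) _    =
      (λ x∸m≤z+m → step-into-gap zy y<x∸m x∸m≤z+m , subst (y + m ≤_) (sym (m∸n+n≡m m≤x)) (<⇒≤ y+m<x)) ,
      (λ _ → step-shift zy , +-monoˡ-≤ m y≤z+m)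
      where
      m≤x : m ≤ x
      m≤x = ≤-trans (m≤n+m m y) (<⇒≤ y+m<x)

  settleAll : List ℕ → List ℕ → List ℕ
  settleAll rc []       = rc
  settleAll rc (x ∷ xs) = settleAll (settle x rc) xs

  Room : ℕ → List ℕ → Set
  Room n []       = ⊤
  Room n (x ∷ xs) = x ≤ n * m × Room (suc n) xs

  settleAll-good : ∀ xs rc → Settled rc → Linked Step xs → Head (λ h → Head (Step h) xs) rc →
    Room (length rc) xs → Settled (settleAll rc xs)
  settleAll-good []       rc good _  _    _               = good
  settleAll-good (x ∷ xs) rc good lk step (room , rooms) =
    settleAll-good xs (settle x rc) (settle-good x rc good room (first rc step)) (Linked.tail lk)
                   (next xs lk) (subst (λ n → Room n xs) (sym (settle-length x rc)) rooms)
    where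
    first : ∀ rc → Head (λ h → Head (Step h) (x ∷ xs)) rc → Head (λ h → Step h x) rc
    first []      _ = tt
    first (_ ∷ _) s = s
    at-most-x : Head (_≤ x) (settle x rc)
    at-most-x = subst (Head (_≤ x)) (ListP.++-identityʳ (settle x rc)) (settle-head (_≤ x) x rc [] (cases rc))
      where
      cases : ∀ rc → HeadCases (_≤ x) x rc
      cases []      = ≤-refl
      cases (_ ∷ _) = (λ _ → ≤-refl) , <⇒≤
    -- the new last column is at most x, so it may precede the next column of xs
    next : ∀ xs → Linked Step (x ∷ xs) → Head (λ h → Head (Step h) xs) (settle x rc)
    next []       _        = Head-map (λ _ → tt) (settle x rc) at-most-x
    next (x′ ∷ _) (st ∷ _) = Head-map (λ h≤x → step-weaken h≤x st) (settle x rc) at-most-x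

-- Settling only permutes the linear factors of P.
module SettlingPolynomial (m : ℕ) .{{_ : NonZero m}} where

  open import Data.List using (List; []; _∷_; _++_; length; reverse; reverseAcc)
  import Data.List.Properties as ListP
  open import Data.Nat as ℕ using (ℕ; suc; _≤_; _≤?_; NonZero)
  import Data.Nat.Properties as ℕP
  open import Data.Integer using (ℤ; +_; _+_; _*_; _-_; 1ℤ)
  import Data.Integer.Properties as ℤP
  open import Data.Integer.Tactic.RingSolver using (solve-∀)
  open import Relation.Nullary using (yes; no)
  open import Relation.Binary.PropositionalEquality
  open Polynomial m
  open Settling m

  -- The polynomial P of the board whose columns are rc read backwards.
  PR : List ℕ → ℤ → ℤ
  PR []       Y = 1ℤ
  PR (x ∷ rc) Y = PR rc Y * (Y - μ (length rc) + + x)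

  record _≈R_ (A B : List ℕ) : Set where
    field
      length-eq : length A ≡ length B
      PR-eq     : ∀ Y → PR A Y ≡ PR B Y
  open _≈R_

  ≈R-trans : ∀ {A B C} → A ≈R B → B ≈R C → A ≈R C
  ≈R-trans e₁ e₂ = record { length-eq = trans (length-eq e₁) (length-eq e₂) ; PR-eq = λ Y → trans (PR-eq e₁ Y) (PR-eq e₂ Y) }

  ≈R-cons : ∀ x {A B} → A ≈R B → (x ∷ A) ≈R (x ∷ B)
  ≈R-cons x e = record
    { length-eq = cong suc (length-eq e)
    ; PR-eq     = λ Y → cong₂ (λ p n → p * (Y - μ n + + x)) (PR-eq e Y) (length-eq e)
    }

  -- Exchanging x for y + m and settling x − m permutes the linear factors.
  settle-PR : ∀ x rc → settle x rc ≈R (x ∷ rc)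
  settle-PR x []       = record { length-eq = refl ; PR-eq = λ Y → refl }
  settle-PR x (y ∷ ys) with x ≤? y ℕ.+ m
  ... | yes _     = record { length-eq = refl ; PR-eq = λ Y → refl }
  ... | no  x≰y+m = record { length-eq = cong suc (settle-length (x ℕ.∸ m) ys) ; PR-eq = exchange }
    where
    n = length ys
    m≤x : m ≤ x
    m≤x = ℕP.≤-trans (ℕP.m≤n+m m y) (ℕP.<⇒≤ (ℕP.≰⇒> x≰y+m))
    exchange : ∀ Y → PR (y ℕ.+ m ∷ settle (x ℕ.∸ m) ys) Y ≡ PR (x ∷ y ∷ ys) Y
    exchange Y = begin
        PR (settle (x ℕ.∸ m) ys) Y * (Y - μ (length (settle (x ℕ.∸ m) ys)) + + (y ℕ.+ m))
      ≡⟨ cong₂ (λ p l → p * (Y - μ l + + (y ℕ.+ m))) (PR-eq (settle-PR (x ℕ.∸ m) ys) Y) (settle-length (x ℕ.∸ m) ys) ⟩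
        PR ys Y * (Y - μ n + + (x ℕ.∸ m)) * (Y - μ (suc n) + + (y ℕ.+ m))
      ≡⟨ cong₂ (λ a b → PR ys Y * (Y - μ n + a) * (Y - b + + (y ℕ.+ m))) x∸m (μ-suc n) ⟩
        PR ys Y * (Y - μ n + (+ x - + m)) * (Y - (+ m + μ n) + + (y ℕ.+ m))
      ≡⟨ cong (λ c → PR ys Y * (Y - μ n + (+ x - + m)) * (Y - (+ m + μ n) + c)) (ℤP.pos-+ y m) ⟩
        PR ys Y * (Y - μ n + (+ x - + m)) * (Y - (+ m + μ n) + (+ y + + m))
      ≡⟨ swap (PR ys Y) Y (μ n) (+ x) (+ m) (+ y) ⟩
        PR ys Y * (Y - μ n + + y) * (Y - (+ m + μ n) + + x)
      ≡⟨ cong (λ b → PR ys Y * (Y - μ n + + y) * (Y - b + + x)) (sym (μ-suc n)) ⟩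
        PR ys Y * (Y - μ n + + y) * (Y - μ (suc n) + + x)
      ∎
      where
      open ≡-Reasoning
      x∸m : + (x ℕ.∸ m) ≡ + x - + m
      x∸m = trans (sym (ℤP.⊖-≥ m≤x)) (sym (ℤP.m-n≡m⊖n x m))
      swap : ∀ p y a x m z → p * (y - a + (x - m)) * (y - (m + a) + (z + m)) ≡ p * (y - a + z) * (y - (m + a) + x)
      swap = solve-∀

  settleAll-PR : ∀ xs rc → settleAll rc xs ≈R reverseAcc rc xs
  settleAll-PR []       rc = record { length-eq = refl ; PR-eq = λ Y → refl }
  settleAll-PR (x ∷ xs) rc = ≈R-trans (settleAll-PR xs (settle x rc)) (reverseAcc-cong xs (settle-PR x rc))
    where
    reverseAcc-cong : ∀ xs {A B} → A ≈R B → reverseAcc A xs ≈R reverseAcc B xs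
    reverseAcc-cong []       e = e
    reverseAcc-cong (x ∷ xs) e = reverseAcc-cong xs (≈R-cons x e)

  P-snoc : ∀ A x Y → P (A ++ x ∷ []) Y ≡ P A Y * (Y - μ (length A) + + x)
  P-snoc []      x Y = trans (ℤP.*-identityʳ _) (sym (trans (ℤP.*-identityˡ _) (cong (_+ + x) (ℤP.+-identityʳ Y))))
  P-snoc (b ∷ A) x Y = begin
      (Y + + b) * P (A ++ x ∷ []) (Y - + m)
    ≡⟨ cong ((Y + + b) *_) (P-snoc A x (Y - + m)) ⟩
      (Y + + b) * (P A (Y - + m) * (Y - + m - μ (length A) + + x))
    ≡⟨ regroup (Y + + b) (P A (Y - + m)) Y (+ m) (μ (length A)) (+ x) ⟩
      (Y + + b) * P A (Y - + m) * (Y - (+ m + μ (length A)) + + x)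
    ≡⟨ cong (λ w → (Y + + b) * P A (Y - + m) * (Y - w + + x)) (sym (μ-suc (length A))) ⟩
      (Y + + b) * P A (Y - + m) * (Y - μ (length (b ∷ A)) + + x)
    ∎
    where
    open ≡-Reasoning
    regroup : ∀ c p y m a x → c * (p * (y - m - a + x)) ≡ c * p * (y - (m + a) + x)
    regroup = solve-∀

  PR-P : ∀ rc Y → PR rc Y ≡ P (reverse rc) Y
  PR-P []       Y = refl
  PR-P (x ∷ rc) Y = begin
      PR rc Y * (Y - μ (length rc) + + x)
    ≡⟨ cong₂ (λ p l → p * (Y - μ l + + x)) (PR-P rc Y) (sym (ListP.length-reverse rc)) ⟩
      P (reverse rc) Y * (Y - μ (length (reverse rc)) + + x)
    ≡⟨ sym (P-snoc (reverse rc) x Y) ⟩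
      P (reverse rc ++ x ∷ []) Y
    ≡⟨ cong (λ L → P L Y) (sym (ListP.unfold-reverse x rc)) ⟩
      P (reverse (x ∷ rc)) Y
    ∎
    where open ≡-Reasoning

module Assembly where

  open Counting
  open SingletonBoards
  open FactorizationTheorem
  open import Data.List using (List; []; _∷_; _++_; length; reverse; reverseAcc; replicate)
  import Data.List.Properties as ListP
  open import Data.List.Relation.Unary.All as All using (All; []; _∷_)
  open import Data.List.Relation.Unary.Linked using (Linked; []; [-]; _∷_)
  import Data.List.Relation.Unary.Linked as Linked
  open import Data.Nat using (ℕ; zero; suc; _+_; _≤_; NonZero; z≤n)
  open import Data.Nat.ListAction using (sum)
  import Data.Nat.Properties as ℕP
  open import Data.Integer using (+_)
  import Data.Integer.Properties as ℤP
  open import Data.Product using (_,_; proj₁; proj₂)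
  open import Data.Unit using (tt)
  open import Function using (flip)
  open import Relation.Binary.PropositionalEquality

  linked-reverseAcc : ∀ {R : ℕ → ℕ → Set} xs acc → Linked (flip R) xs → Linked R acc →
    Head (λ x → Head (R x) acc) xs → Linked R (reverseAcc acc xs)
  linked-reverseAcc []       acc _   lacc _ = lacc
  linked-reverseAcc (x ∷ xs) acc lxs lacc c =
    linked-reverseAcc xs (x ∷ acc) (Linked.tail lxs) (linked-cons acc c lacc) (linked-head xs lxs)

  linked-reverse : ∀ {R : ℕ → ℕ → Set} xs → Linked (flip R) xs → Linked R (reverse xs)
  linked-reverse []       l = []
  linked-reverse (x ∷ xs) l = linked-reverseAcc (x ∷ xs) [] l [] tt

  all≤sum : ∀ S → All (_≤ sum S) S
  all≤sum []      = []
  all≤sum (x ∷ S) = ℕP.m≤m+n x (sum S) ∷ All.map (λ le → ℕP.≤-trans le (ℕP.m≤n+m (sum S) x)) (all≤sum S)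

  module Main (m : ℕ) .{{_ : NonZero m}} where
    open RookNumbers m
    open Normalisation m
    open Factorization m
    open Polynomial m
    open Settling m
    open SettlingPolynomial m

    pad : ℕ → List ℕ → List ℕ
    pad k L = replicate k 0 ++ L

    pad-strip : ∀ k L → stripZeros (pad k L) ≡ stripZeros L
    pad-strip zero    L = refl
    pad-strip (suc k) L = pad-strip k L

    pad-length : ∀ k L → length (pad k L) ≡ k + length L
    pad-length k L = trans (ListP.length-++ (replicate k 0)) (cong (_+ length L) (ListP.length-replicate k))

    pad-linked : ∀ k L → Linked Step L → Linked Step (pad k L)
    pad-linked zero    L l = l
    pad-linked (suc k) L l = linked-cons (pad k L) (zero-first (pad k L)) (pad-linked k L l)
      where
      zero-first : ∀ L → Head (Step 0) L
      zero-first []      = tt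
      zero-first (h ∷ _) = step-from-0 h

    pad-restricted : ∀ k L → Restricted m L → Restricted m (pad k L)
    pad-restricted zero    L r = r
    pad-restricted (suc k) L r = z≤n ∷ pad-restricted k L r

    pad-g : ∀ k L j → g (pad k L) 0 j ≡ g L 0 j
    pad-g zero    L j       = refl
    pad-g (suc k) L zero    = pad-g k L zero
    pad-g (suc k) L (suc j) = trans (ℤP.+-identityʳ _) (pad-g k L (suc j))

    -- Enough leading zeros leave room to settle every column.
    room-padded : ∀ S → Room 0 (pad (sum S) S)
    room-padded S = room-pad (sum S) 0 S (subst (λ n → Room n S) (sym (ℕP.+-identityˡ (sum S))) (room (sum S) S (all≤sum S)))
      where
      room : ∀ n S → All (_≤ n) S → Room n S
      room n []      _          = tt
      room n (x ∷ S) (x≤n ∷ S≤n) = ℕP.≤-trans x≤n (ℕP.m≤m*n n m) , room (suc n) S (All.map ℕP.m≤n⇒m≤1+n S≤n)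
      room-pad : ∀ k n S → Room (n + k) S → Room n (pad k S)
      room-pad zero    n S r = subst (λ z → Room z S) (ℕP.+-identityʳ n) r
      room-pad (suc k) n S r = z≤n , room-pad k (suc n) S (subst (λ z → Room z S) (ℕP.+-suc n k) r)

    rook-from-g : ∀ L L′ → Linked Step L → Linked Step L′ → (∀ k → g L 0 k ≡ g L′ 0 k) →
      ∀ k → rookNumber k m L ≡ rookNumber k m L′
    rook-from-g L L′ l l′ eq k = ℤP.+-injective (trans (rook-g L k l) (trans (eq k) (sym (rook-g L′ k l′))))

    g-from-rook : ∀ L L′ → Linked Step L → Linked Step L′ → (∀ k → rookNumber k m L ≡ rookNumber k m L′) →
      ∀ k → g L 0 k ≡ g L′ 0 k
    g-from-rook L L′ l l′ eq k = trans (sym (rook-g L k l)) (trans (cong +_ (eq k)) (rook-g L′ k l′))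

    -- Normalise B to a singleton board S, pad it with sum S zero
    -- columns and settle the columns one by one into a restricted board C.
    -- C has the polynomial P of the padded board, hence the same g and the
    -- same rook numbers.
    module Existence (B : List ℕ) (ferrers : IsFerrers B) where
      S  = normalForm B
      S′ = pad (sum S) S
      rc = settleAll [] S′
      C  = reverse rc

      S-normalised : Normalised B S
      S-normalised = normalForm-inv B ferrers

      S′-linked : Linked Step S′
      S′-linked = pad-linked (sum S) S (Normalised.linked S-normalised)

      C-linked : Linked StepR (0 ∷ C)
      C-linked = subst (Linked StepR) (ListP.reverse-++ rc (0 ∷ []))
        (linked-reverse (rc ++ 0 ∷ []) (settleAll-good S′ [] [-] S′-linked tt (room-padded S)))

      C-step : Linked Step C
      C-step = Linked.tail (proj₁ (Linked.unzip C-linked))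

      C-ferrers : IsFerrers C
      C-ferrers = proj₁ (Linked.unzip C-step)

      C-singleton : Singleton m C
      C-singleton = proj₂ (Linked.unzip C-step)

      C-restricted : Restricted m C
      C-restricted = proj₂ (Linked.unzip C-linked)

      rc≈S′ : rc ≈R reverse S′
      rc≈S′ = settleAll-PR S′ []

      C-length : length C ≡ length S′
      C-length = trans (ListP.length-reverse rc) (trans (_≈R_.length-eq rc≈S′) (ListP.length-reverse S′))

      C-P : ∀ Y → P C Y ≡ P S′ Y
      C-P Y = trans (sym (PR-P rc Y)) (trans (_≈R_.PR-eq rc≈S′ Y)
                    (trans (PR-P (reverse S′) Y) (cong (λ L → P L Y) (ListP.reverse-involutive S′))))

      C-equiv : RookEquiv m B C
      C-equiv k = begin
          rookNumber k m B
        ≡⟨ rookNumber-G k B ⟩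
          G B [] k
        ≡⟨ sym (G-eq (Normalised.counts S-normalised) [] k) ⟩
          G S [] k
        ≡⟨ sym (rookNumber-G k S) ⟩
          rookNumber k m S
        ≡⟨ rook-from-g S C (Normalised.linked S-normalised) C-step g-eq k ⟩
          rookNumber k m C
        ∎
        where
        open ≡-Reasoning
        g-eq : ∀ j → g S 0 j ≡ g C 0 j
        g-eq j = trans (sym (pad-g (sum S) S j)) (sym (P⇒g C S′ C-length (λ t → C-P (μ t)) j))

    -- Uniqueness.  Pad C and D to a common length; equal rook numbers give
    -- equal g, hence equal polynomials, and restricted boards are determined
    -- by their polynomial.
    uniqueness : ∀ C D → Linked Step C → Restricted m C → Linked Step D → Restricted m D →
      (∀ k → rookNumber k m C ≡ rookNumber k m D) → SameBoard C D
    uniqueness C D stepC rstC stepD rstD eq =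
      trans (sym (pad-strip (length D) C)) (trans (cong stripZeros C′≡D′) (pad-strip (length C) D))
      where
      C′ = pad (length D) C
      D′ = pad (length C) D
      same-length : length C′ ≡ length D′
      same-length = trans (pad-length (length D) C) (trans (ℕP.+-comm (length D) (length C)) (sym (pad-length (length C) D)))
      same-g : ∀ k → g C′ 0 k ≡ g D′ 0 k
      same-g k = trans (pad-g (length D) C k) (trans (g-from-rook C D stepC stepD eq k) (sym (pad-g (length C) D k)))
      C′≡D′ : C′ ≡ D′
      C′≡D′ = restricted-unique C′ D′ same-length (Linked.tail (pad-restricted (length D) C rstC))
                                (Linked.tail (pad-restricted (length C) D rstD)) (g⇒P C′ D′ same-length same-g)

import Data.List.Relation.Unary.Linked as Linked
open import Relation.Binary.PropositionalEquality using (sym; trans)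

corollary7p5 : (m : ℕ) .{{_ : NonZero m}} → (B : List ℕ) → IsFerrers B →
  Σ (List ℕ) (λ C →
    (IsFerrers C × Restricted m C × Singleton m C × RookEquiv m B C) ×
    ((D : List ℕ) → IsFerrers D → Restricted m D → Singleton m D →
      RookEquiv m B D → SameBoard C D))
corollary7p5 m B ferrers = C , (C-ferrers , C-restricted , C-singleton , C-equiv) , unique
  where
  open Assembly.Main m
  open Existence B ferrers
  unique : (D : List ℕ) → IsFerrers D → Restricted m D → Singleton m D → RookEquiv m B D → SameBoard C D
  unique D ferrersD restrictedD singletonD equivD =
    uniqueness C D C-step C-restricted (Linked.zip (ferrersD , singletonD)) restrictedD
               (λ k → trans (sym (C-equiv k)) (equivD k))
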